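{- The restrictions $\Phi_1$ of $\Phi$ to $Av(T_1)$ and $\Phi_2$ of $\Phi$ to $Av(T_2)$ are both bijections onto the set of Dyck prefixes of even length; more precisely, for every $n\ge0$, each $\Phi_i$ maps $S_{n+1}(T_i)$ bijectively onto the set of Dyck prefixes of length $2n$. Hence $|S_{n+1}(T_1)|=|S_{n+1}(T_2)|=\binom{2n}{n}$ for every $n\ge 0$.
   Context: A permutation $\sigma$ avoids $\tau$ if no subsequence of $\sigma$ has the same relative order as $\tau$. Let $T_1=\{3214,3241,4213,4231\}$ and $T_2=\{3124,3142,4123,4132\}$; $Av(T)$ is the set of permutations avoiding all patterns of $T$, and $S_n(T)=Av(T)\cap S_n$. A Dyck prefix is a lattice path starting at the origin with steps $U=(1,1)$ and $D=(1,-1)$ that never goes below the $x$-axis (equivalently a word in $U,D$ each of whose initial subwords has at least as many $U$'s as $D$'s). The map $\Phi$ from $Av(T_1)\cup Av(T_2)$ to Dyck prefixes is defined as follows. The permutation $1$ is mapped to the empty path. For $n\ge1$ and $\sigma\in S_{n+1}(T_1)\cup S_{n+1}(T_2)$, write $\sigma=M_1w_1M_2w_2\cdots M_kw_k$, where $M_1<\cdots<M_k=n+1$ are the left-to-right maxima of $\sigma$ (entries larger than all preceding entries) and $w_i$ is a possibly empty word of length $l_i$; set $M_0=0$. If $w_k$ is empty, $\Phi(\sigma)=U^{M_1-M_0}D^{l_1+1}U^{M_2-M_1}D^{l_2+1}\cdots U^{M_{k-1}-M_{k-2}}D^{l_{k-1}+1}$. If $w_k=x_1\cdots x_{l_k}$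 is nonempty, $\Phi(\sigma)=U^{M_1-M_0}D^{l_1+1}\cdots U^{M_{k-1}-M_{k-2}}D^{l_{k-1}+1}U^{M_k-M_{k-1}}Q_1\cdots Q_{l_k-1}$, where $Q_j=U$ if $x_j=\max\{x_j,x_{j+1},\dots,x_{l_k}\}$ and $Q_j=D$ otherwise. -}

module Defs where

open import Data.Nat using (ℕ; zero; suc; _+_; _*_; _∸_; _<_; _≤ᵇ_; _⊔_; _<?_)
open import Data.Bool using (Bool; true; false; if_then_else_)
open import Data.List using (List; []; _∷_; _++_; length; lookup; take; map; upTo; span; replicate; foldr)
open import Data.List.Relation.Binary.Permutation.Propositional using (_↭_)
open import Data.List.Relation.Binary.Sublist.Propositional using (_⊆_)
open import Data.List.Relation.Unary.All using (All)
open import Data.Fin using (Fin; cast)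
open import Data.Product using (Σ; _×_; _,_)
open import Relation.Binary.PropositionalEquality using (_≡_)
open import Relation.Nullary using (¬_)
open import Function.Bundles using (_⇔_)

-- A permutation of length m, written in one-line notation as a list of
-- the values 1..m.
IsPerm : ℕ → List ℕ → Set
IsPerm m σ = σ ↭ map suc (upTo m)

SameOrder : List ℕ → List ℕ → Set
SameOrder xs ys =
  Σ (length xs ≡ length ys) λ eq →
    ∀ (i j : Fin (length xs)) →
      (lookup xs i < lookup xs j) ⇔ (lookup ys (cast eq i) < lookup ys (cast eq j))

Contains : List ℕ → List ℕ → Set
Contains σ τ = Σ (List ℕ) λ s → (s ⊆ σ) × SameOrder s τ

Avoids : List (List ℕ) → List ℕ → Set
Avoids T σ = All (λ τ → ¬ Contains σ τ) T

InS : List (List ℕ) → ℕ → List ℕ → Set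
InS T m σ = IsPerm m σ × Avoids T σ

T₁ : List (List ℕ)
T₁ = (3 ∷ 2 ∷ 1 ∷ 4 ∷ []) ∷ (3 ∷ 2 ∷ 4 ∷ 1 ∷ []) ∷ (4 ∷ 2 ∷ 1 ∷ 3 ∷ []) ∷ (4 ∷ 2 ∷ 3 ∷ 1 ∷ []) ∷ []

T₂ : List (List ℕ)
T₂ = (3 ∷ 1 ∷ 2 ∷ 4 ∷ []) ∷ (3 ∷ 1 ∷ 4 ∷ 2 ∷ []) ∷ (4 ∷ 1 ∷ 2 ∷ 3 ∷ []) ∷ (4 ∷ 1 ∷ 3 ∷ 2 ∷ []) ∷ []

data Step : Set where
  U D : Step

countU countD : List Step → ℕ
countU [] = 0
countU (U ∷ w) = suc (countU w)
countU (D ∷ w) = countU w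
countD [] = 0
countD (U ∷ w) = countD w
countD (D ∷ w) = suc (countD w)

IsDyckPrefix : List Step → Set
IsDyckPrefix w = ∀ k → countD (take k w) Data.Nat.≤ countU (take k w)

DyckPrefixOfLength : ℕ → List Step → Set
DyckPrefixOfLength len w = (length w ≡ len) × IsDyckPrefix w

-- Decomposition σ = M₁ w₁ M₂ w₂ ⋯ M_k w_k into left-to-right maxima M_i
-- and the words w_i following them (w_i = the maximal run of entries
-- smaller than M_i after M_i).  The first argument is fuel (≥ length).
blocksF : ℕ → List ℕ → List (ℕ × List ℕ)
blocksF zero _ = []
blocksF (suc f) [] = []
blocksF (suc f) (x ∷ xs) with span (λ y → y <? x) xs
... | (w , rest) = (x , w) ∷ blocksF f rest

blocks : List ℕ → List (ℕ × List ℕ)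
blocks σ = blocksF (length σ) σ

-- Q_j = U iff x_j is the maximum of x_j ⋯ x_l ; j = 1 .. l-1
Qs : List ℕ → List Step
Qs [] = []
Qs (x ∷ []) = []
Qs (x ∷ y ∷ ys) = (if foldr _⊔_ 0 (y ∷ ys) ≤ᵇ x then U else D) ∷ Qs (y ∷ ys)

-- first argument: the previous left-to-right maximum M_{i-1} (M₀ = 0)
ΦBlocks : ℕ → List (ℕ × List ℕ) → List Step
ΦBlocks prev [] = []
ΦBlocks prev ((M , []) ∷ []) = []
ΦBlocks prev ((M , (x ∷ xs)) ∷ []) = replicate (M ∸ prev) U ++ Qs (x ∷ xs)
ΦBlocks prev ((M , w) ∷ (b ∷ bs)) =
  replicate (M ∸ prev) U ++ replicate (suc (length w)) D ++ ΦBlocks M (b ∷ bs)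

Φ : List ℕ → List Step
Φ σ = ΦBlocks 0 (blocks σ)

module Submission where

-- Avoidance of T_K is equivalent to a local condition Good on
-- each entry that is not a left-to-right maximum (module Avoidance).  This
-- condition determines every such entry from the set of still unused values,
-- which yields an explicit decoder ψ (module Decoder) reading the path from
-- left to right.  We show ψ (Φ σ) = σ for σ ∈ S_{n+1}(T_K) and that Φ σ is a
-- Dyck prefix of length 2n (DecodeEncode), and that for every such prefix p,
-- ψ p lies in S_{n+1}(T_K) with Φ (ψ p) = p (EncodeDecode); in both proofs the
-- height of the path equals the number of unused values below the current
-- maximum.

open import Defs
open import Data.Nat using (ℕ; suc; _*_)
open import Data.Nat.Combinatorics using (_C_)
open import Data.List using (List; length)
open import Data.List.Membership.Propositional using (_∈_)
open import Data.List.Relation.Unary.Unique.Propositional using (Unique)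
open import Data.Product using (Σ; _×_; ∃)
open import Data.Sum using (_⊎_)
open import Relation.Binary.PropositionalEquality using (_≡_)
open import Function.Bundles using (_⇔_)

module DyckPaths where

  open import Data.Nat
  open import Data.Nat.Properties
  open import Data.Nat.Combinatorics using (_C_; nCk+nC[k+1]≡[n+1]C[k+1])
  open import Data.Nat.Combinatorics.Specification using (k>n⇒nCk≡0)
  open import Data.List using (List; []; _∷_; _++_; length; map; take)
  open import Data.List.Properties using (length-map; length-++; ∷-injectiveʳ)
  open import Data.List.Membership.Propositional using (_∈_)
  open import Data.List.Membership.Propositional.Properties using (∈-map⁺; ∈-map⁻; ∈-++⁺ˡ; ∈-++⁺ʳ; ∈-++⁻)
  open import Data.List.Relation.Unary.Any using (here)
  open import Data.List.Relation.Unary.Unique.Propositional using (Unique)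
  import Data.List.Relation.Unary.Unique.Propositional.Properties as UP
  open import Data.List.Relation.Unary.AllPairs using ([]; _∷_)
  import Data.List.Relation.Unary.All as All
  open import Data.Product using (_×_; _,_)
  open import Data.Sum using (inj₁; inj₂)
  open import Data.Empty using (⊥; ⊥-elim)
  open import Relation.Nullary using (¬_; Dec; yes; no)
  open import Relation.Binary.Definitions using (tri<; tri≈; tri>)
  open import Relation.Binary.PropositionalEquality
  open import Function.Bundles using (_⇔_; mk⇔)
  import Algebra.Properties.CommutativeSemigroup as CSP

  two*n : ∀ n → 2 * n ≡ n + n
  two*n n = cong (n +_) (+-identityʳ n)

  -- DyckFrom h w : the step sequence w never goes below the x-axis when it
  -- starts at height h.  This inductive form replaces the prefix-counting
  -- definition IsDyckPrefix in all proofs.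
  data DyckFrom : ℕ → List Step → Set where
    nil  : ∀ {h} → DyckFrom h []
    up   : ∀ {h w} → DyckFrom (suc h) w → DyckFrom h (U ∷ w)
    down : ∀ {h w} → DyckFrom h w → DyckFrom (suc h) (D ∷ w)

  dyck⇒ : ∀ {h w} → DyckFrom h w → ∀ k → countD (take k w) ≤ h + countU (take k w)
  dyck⇒ nil zero = z≤n
  dyck⇒ nil (suc k) = z≤n
  dyck⇒ (up d) zero = z≤n
  dyck⇒ {h} (up {w = w} d) (suc k) =
    subst (countD (take k w) ≤_) (sym (+-suc h (countU (take k w)))) (dyck⇒ d k)
  dyck⇒ (down d) zero = z≤n
  dyck⇒ (down d) (suc k) = s≤s (dyck⇒ d k)

  dyck⇐ : ∀ h w → (∀ k → countD (take k w) ≤ h + countU (take k w)) → DyckFrom h w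
  dyck⇐ h [] _ = nil
  dyck⇐ h (U ∷ w) f = up (dyck⇐ (suc h) w λ k →
    subst (countD (take k w) ≤_) (+-suc h (countU (take k w))) (f (suc k)))
  dyck⇐ zero (D ∷ w) f with f 1
  ... | ()
  dyck⇐ (suc h) (D ∷ w) f = down (dyck⇐ h w λ k → s≤s⁻¹ (f (suc k)))

  isDyck⇔ : ∀ w → IsDyckPrefix w ⇔ DyckFrom 0 w
  isDyck⇔ w = mk⇔ (dyck⇐ 0 w) (λ d → dyck⇒ d)

  paths : ℕ → ℕ → List (List Step)
  paths zero h = [] ∷ []
  paths (suc m) zero = map (U ∷_) (paths m 1)
  paths (suc m) (suc h) = map (U ∷_) (paths m (suc (suc h))) ++ map (D ∷_) (paths m h)

  paths-sound : ∀ m h p → p ∈ paths m h → length p ≡ m × DyckFrom h p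
  paths-sound zero h .[] (here refl) = refl , nil
  paths-sound (suc m) zero p pin with ∈-map⁻ (U ∷_) pin
  ... | q , qin , refl with paths-sound m 1 q qin
  ... | e , d = cong suc e , up d
  paths-sound (suc m) (suc h) p pin with ∈-++⁻ (map (U ∷_) (paths m (suc (suc h)))) pin
  ... | inj₁ pin' with ∈-map⁻ (U ∷_) pin'
  ...   | q , qin , refl with paths-sound m (suc (suc h)) q qin
  ...     | e , d = cong suc e , up d
  paths-sound (suc m) (suc h) p pin | inj₂ pin' with ∈-map⁻ (D ∷_) pin'
  ...   | q , qin , refl with paths-sound m h q qin
  ...     | e , d = cong suc e , down d

  paths-complete : ∀ m h p → length p ≡ m → DyckFrom h p → p ∈ paths m h
  paths-complete zero h [] e d = here refl
  paths-complete (suc m) zero (U ∷ p) e (up d) = ∈-map⁺ (U ∷_) (paths-complete m 1 p (suc-injective e) d)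
  paths-complete (suc m) (suc h) (U ∷ p) e (up d) =
    ∈-++⁺ˡ (∈-map⁺ (U ∷_) (paths-complete m (suc (suc h)) p (suc-injective e) d))
  paths-complete (suc m) (suc h) (D ∷ p) e (down d) =
    ∈-++⁺ʳ (map (U ∷_) (paths m (suc (suc h)))) (∈-map⁺ (D ∷_) (paths-complete m h p (suc-injective e) d))

  -- paths m h has no repetitions: its two halves differ in the first step.
  paths-unique : ∀ m h → Unique (paths m h)
  paths-unique zero h = All.[] ∷ []
  paths-unique (suc m) zero = UP.map⁺ ∷-injectiveʳ (paths-unique m 1)
  paths-unique (suc m) (suc h) =
    UP.++⁺ (UP.map⁺ ∷-injectiveʳ (paths-unique m (suc (suc h))))
           (UP.map⁺ ∷-injectiveʳ (paths-unique m h))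
           disjoint
    where
    disjoint : ∀ {v} → ¬ (v ∈ map (U ∷_) (paths m (suc (suc h))) × v ∈ map (D ∷_) (paths m h))
    disjoint (a , b) with ∈-map⁻ (U ∷_) a | ∈-map⁻ (D ∷_) b
    ... | _ , _ , refl | _ , _ , ()

  -- We show that the number of nonnegative paths of length
  -- m from height a is the binomial sum over the window m − a ≤ 2k ≤ m + a + 1,
  --   windowSum m a = Σ_{k ≤ m} C(m,k) · [m ≤ 2k + a] · [2k ≤ m + a + 1],
  -- by checking that the window sums satisfy the same recursion as the paths
  -- (using Pascal's rule); for m = 2n, a = 0 only k = n survives.

  sumF : ℕ → (ℕ → ℕ) → ℕ
  sumF zero g = 0
  sumF (suc K) g = g 0 + sumF K (λ k → g (suc k))

  sumF-cong : ∀ K {f g : ℕ → ℕ} → (∀ k → f k ≡ g k) → sumF K f ≡ sumF K g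
  sumF-cong zero e = refl
  sumF-cong (suc K) e = cong₂ _+_ (e 0) (sumF-cong K (λ k → e (suc k)))

  sumF-+ : ∀ K (f g : ℕ → ℕ) → sumF K (λ k → f k + g k) ≡ sumF K f + sumF K g
  sumF-+ zero f g = refl
  sumF-+ (suc K) f g rewrite sumF-+ K (λ k → f (suc k)) (λ k → g (suc k)) =
    CSP.interchange +-commutativeSemigroup (f 0) (g 0) (sumF K (λ k → f (suc k))) (sumF K (λ k → g (suc k)))

  sumF-last0 : ∀ K (f : ℕ → ℕ) → f K ≡ 0 → sumF (suc K) f ≡ sumF K f
  sumF-last0 zero f e = trans (+-identityʳ (f 0)) e
  sumF-last0 (suc K) f e = cong (f 0 +_) (sumF-last0 K (λ k → f (suc k)) e)

  pascal-sum : ∀ m (f : ℕ → ℕ) →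
    sumF (suc (suc m)) (λ k → (suc m C k) * f k) ≡ sumF (suc m) (λ k → (m C k) * (f k + f (suc k)))
  pascal-sum m f = begin
      1 * f 0 + sumF (suc m) (λ k → (suc m C suc k) * f (suc k))
    ≡⟨ cong (1 * f 0 +_) (sumF-cong (suc m) (λ k → trans (cong (_* f (suc k)) (sym (nCk+nC[k+1]≡[n+1]C[k+1] m k))) (*-distribʳ-+ (f (suc k)) (m C k) (m C suc k)))) ⟩
      1 * f 0 + sumF (suc m) (λ k → (m C k) * f (suc k) + (m C suc k) * f (suc k))
    ≡⟨ cong (1 * f 0 +_) (sumF-+ (suc m) (λ k → (m C k) * f (suc k)) (λ k → (m C suc k) * f (suc k))) ⟩
      1 * f 0 + (A + sumF (suc m) (λ k → (m C suc k) * f (suc k)))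
    ≡⟨ cong (λ z → 1 * f 0 + (A + z)) (sumF-last0 m (λ k → (m C suc k) * f (suc k)) (cong (_* f (suc m)) (k>n⇒nCk≡0 (n<1+n m)))) ⟩
      1 * f 0 + (A + sumF m (λ k → (m C suc k) * f (suc k)))
    ≡⟨ regroup (1 * f 0) A (sumF m (λ k → (m C suc k) * f (suc k))) ⟩
      (1 * f 0 + sumF m (λ k → (m C suc k) * f (suc k))) + A
    ≡⟨ sym (sumF-+ (suc m) (λ k → (m C k) * f k) (λ k → (m C k) * f (suc k))) ⟩
      sumF (suc m) (λ k → (m C k) * f k + (m C k) * f (suc k))
    ≡⟨ sumF-cong (suc m) (λ k → sym (*-distribˡ-+ (m C k) (f k) (f (suc k)))) ⟩
      sumF (suc m) (λ k → (m C k) * (f k + f (suc k)))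
    ∎
    where
    open ≡-Reasoning
    A = sumF (suc m) (λ k → (m C k) * f (suc k))
    regroup : ∀ a b c → a + (b + c) ≡ (a + c) + b
    regroup a b c = trans (cong (a +_) (+-comm b c)) (sym (+-assoc a c b))

  ind : ∀ {P : Set} → Dec P → ℕ
  ind (yes _) = 1
  ind (no _) = 0

  ind-yes : ∀ {P : Set} (p : Dec P) → P → ind p ≡ 1
  ind-yes (yes _) _ = refl
  ind-yes (no ¬p) p = ⊥-elim (¬p p)

  ind-no : ∀ {P : Set} (p : Dec P) → ¬ P → ind p ≡ 0
  ind-no (yes p) ¬p = ⊥-elim (¬p p)
  ind-no (no _) _ = refl

  ind-cong : ∀ {P Q : Set} → (P → Q) → (Q → P) → (p : Dec P) (q : Dec Q) → ind p ≡ ind q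
  ind-cong f g (yes x) (yes y) = refl
  ind-cong f g (yes x) (no y) = ⊥-elim (y (f x))
  ind-cong f g (no x) (yes y) = ⊥-elim (x (g y))
  ind-cong f g (no x) (no y) = refl

  ind-interchange : ∀ {P Q P' Q' : Set} (p : Dec P) (q : Dec Q) (p' : Dec P') (q' : Dec Q') →
    (P → P') → (Q → Q') → (¬ P → ¬ Q → ⊥) →
    ind p * ind q' + ind p' * ind q ≡ ind p' * ind q' + ind p * ind q
  ind-interchange (yes x) (yes y) (yes x') (yes y') f g h = refl
  ind-interchange (yes x) (yes y) (yes x') (no y') f g h = ⊥-elim (y' (g y))
  ind-interchange (yes x) (yes y) (no x') q' f g h = ⊥-elim (x' (f x))
  ind-interchange (yes x) (no y) (yes x') (yes _) f g h = refl
  ind-interchange (yes x) (no y) (yes x') (no _) f g h = refl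
  ind-interchange (yes x) (no y) (no x') q' f g h = ⊥-elim (x' (f x))
  ind-interchange (no x) (yes y) (yes _) (yes y') f g h = refl
  ind-interchange (no x) (yes y) (no _) (yes y') f g h = refl
  ind-interchange (no x) (yes y) p' (no y') f g h = ⊥-elim (y' (g y))
  ind-interchange (no x) (no y) (yes x') (yes y') f g h = ⊥-elim (h x y)
  ind-interchange (no x) (no y) (yes x') (no y') f g h = refl
  ind-interchange (no x) (no y) (no x') q' f g h = refl

  ind-absorb : ∀ {A B C E : Set} (p : Dec A) (b : Dec B) (c : Dec C) (e : Dec E) →
    (A → C) → (E → B) → (A → ¬ E) → (¬ A → E) →
    ind p * ind b + ind c * ind e ≡ ind c * ind b
  ind-absorb (yes a) b (yes c) (yes e) f g h k = ⊥-elim (h a e)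
  ind-absorb (yes a) (yes _) (yes c) (no e) f g h k = refl
  ind-absorb (yes a) (no _) (yes c) (no e) f g h k = refl
  ind-absorb (yes a) b (no c) e f g h k = ⊥-elim (c (f a))
  ind-absorb (no a) (yes b) (yes _) (yes e) f g h k = refl
  ind-absorb (no a) (yes b) (no _) (yes e) f g h k = refl
  ind-absorb (no a) (no b) c (yes e) f g h k = ⊥-elim (b (g e))
  ind-absorb (no a) b c (no e) f g h k = ⊥-elim (e (k a))

  inWindow : ℕ → ℕ → ℕ → ℕ
  inWindow m a k = ind (m ≤? (k + k) + a) * ind ((k + k) ≤? m + suc a)

  windowSum : ℕ → ℕ → ℕ
  windowSum m a = sumF (suc m) (λ k → (m C k) * inWindow m a k)

  double-suc : ∀ k → suc k + suc k ≡ suc (suc (k + k))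
  double-suc k = cong suc (+-suc k k)

  -- The window recursion at positive height: shifting k ↦ k + 1 in the
  -- window for (m + 1, a + 1) splits it into the windows for (m, a + 2), (m, a).
  inWindow-step : ∀ m a k → inWindow (suc m) (suc a) k + inWindow (suc m) (suc a) (suc k) ≡ inWindow m (suc (suc a)) k + inWindow m a k
  inWindow-step m a k = begin
      ind p1 * ind q1 + ind p2 * ind q2
    ≡⟨ cong₂ _+_ (cong₂ _*_ (ind-cong P1⇒ ⇒P1 p1 (m ≤? x + a)) (ind-cong Q1⇒ ⇒Q1 q1 (x ≤? m + suc (suc (suc a)))))
                 (cong₂ _*_ (ind-cong P2⇒ ⇒P2 p2 (m ≤? x + suc (suc a))) (ind-cong Q2⇒ ⇒Q2 q2 (x ≤? m + suc a))) ⟩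
      ind (m ≤? x + a) * ind (x ≤? m + suc (suc (suc a))) + ind (m ≤? x + suc (suc a)) * ind (x ≤? m + suc a)
    ≡⟨ ind-interchange (m ≤? x + a) (x ≤? m + suc a) (m ≤? x + suc (suc a)) (x ≤? m + suc (suc (suc a)))
         (λ le → ≤-trans le (+-monoʳ-≤ x (≤-trans (n≤1+n a) (n≤1+n (suc a)))))
         (λ le → ≤-trans le (+-monoʳ-≤ m (≤-trans (n≤1+n (suc a)) (n≤1+n (suc (suc a))))))
         contra ⟩
      ind (m ≤? x + suc (suc a)) * ind (x ≤? m + suc (suc (suc a))) + ind (m ≤? x + a) * ind (x ≤? m + suc a)
    ∎
    where
    open ≡-Reasoning
    x = k + k
    p1 = suc m ≤? x + suc a
    q1 = x ≤? suc m + suc (suc a)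
    p2 = suc m ≤? (suc k + suc k) + suc a
    q2 = (suc k + suc k) ≤? suc m + suc (suc a)
    P1⇒ : suc m ≤ x + suc a → m ≤ x + a
    P1⇒ le = s≤s⁻¹ (subst (suc m ≤_) (+-suc x a) le)
    ⇒P1 : m ≤ x + a → suc m ≤ x + suc a
    ⇒P1 le = subst (suc m ≤_) (sym (+-suc x a)) (s≤s le)
    Q1⇒ : x ≤ suc m + suc (suc a) → x ≤ m + suc (suc (suc a))
    Q1⇒ le = subst (x ≤_) (sym (+-suc m (suc (suc a)))) le
    ⇒Q1 : x ≤ m + suc (suc (suc a)) → x ≤ suc m + suc (suc a)
    ⇒Q1 le = subst (x ≤_) (+-suc m (suc (suc a))) le
    e2 : (suc k + suc k) + suc a ≡ suc (x + suc (suc a))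
    e2 = trans (cong (_+ suc a) (double-suc k)) (cong suc (sym (+-suc x (suc a))))
    P2⇒ : suc m ≤ (suc k + suc k) + suc a → m ≤ x + suc (suc a)
    P2⇒ le = s≤s⁻¹ (subst (suc m ≤_) e2 le)
    ⇒P2 : m ≤ x + suc (suc a) → suc m ≤ (suc k + suc k) + suc a
    ⇒P2 le = subst (suc m ≤_) (sym e2) (s≤s le)
    e3 : suc m + suc (suc a) ≡ suc (suc (m + suc a))
    e3 = cong suc (+-suc m (suc a))
    Q2⇒ : (suc k + suc k) ≤ suc m + suc (suc a) → x ≤ m + suc a
    Q2⇒ le = s≤s⁻¹ (s≤s⁻¹ (subst₂ _≤_ (double-suc k) e3 le))
    ⇒Q2 : x ≤ m + suc a → (suc k + suc k) ≤ suc m + suc (suc a)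
    ⇒Q2 le = subst₂ _≤_ (sym (double-suc k)) (sym e3) (s≤s (s≤s le))
    contra : ¬ (m ≤ x + a) → ¬ (x ≤ m + suc a) → ⊥
    contra np nq = <-irrefl refl (≤-<-trans (m≤m+n x a) (<-trans (≰⇒> np) (≤-<-trans (m≤m+n m (suc a)) (≰⇒> nq))))

  -- The window recursion at height 0, matching paths (m + 1) 0 = U · paths m 1.
  inWindow-step₀ : ∀ m k → inWindow (suc m) 0 k + inWindow (suc m) 0 (suc k) ≡ inWindow m 1 k
  inWindow-step₀ m k = begin
      ind (suc m ≤? x + 0) * ind (x ≤? suc m + 1) + ind (suc m ≤? (suc k + suc k) + 0) * ind ((suc k + suc k) ≤? suc m + 1)
    ≡⟨ cong₂ _+_ (cong₂ _*_ (ind-cong (subst (suc m ≤_) (+-identityʳ x)) (subst (suc m ≤_) (sym (+-identityʳ x))) (suc m ≤? x + 0) dA)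
                            (ind-cong (subst (x ≤_) eB) (subst (x ≤_) (sym eB)) (x ≤? suc m + 1) dB))
                 (cong₂ _*_ (ind-cong (λ le → s≤s⁻¹ (subst (suc m ≤_) eC le)) (λ le → subst (suc m ≤_) (sym eC) (s≤s le)) (suc m ≤? (suc k + suc k) + 0) dC)
                            (ind-cong (λ le → s≤s⁻¹ (s≤s⁻¹ (subst₂ _≤_ (double-suc k) eB le))) (λ le → subst₂ _≤_ (sym (double-suc k)) (sym eB) (s≤s (s≤s le))) ((suc k + suc k) ≤? suc m + 1) dE)) ⟩
      ind dA * ind dB + ind dC * ind dE
    ≡⟨ ind-absorb dA dB dC dE (λ le → ≤-trans (n≤1+n m) (≤-trans le (n≤1+n x))) (λ le → ≤-trans le (≤-trans (n≤1+n m) (n≤1+n (suc m))))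
            (λ le le' → <-irrefl refl (<-≤-trans le le')) (λ nle → s≤s⁻¹ (≰⇒> nle)) ⟩
      ind dC * ind dB
    ≡⟨ sym (cong₂ _*_ (ind-cong (subst (m ≤_) (+-comm x 1)) (subst (m ≤_) (+-comm 1 x)) (m ≤? x + 1) dC)
                      (ind-cong (subst (x ≤_) (+-comm m 2)) (subst (x ≤_) (+-comm 2 m)) (x ≤? m + 2) dB)) ⟩
      ind (m ≤? x + 1) * ind (x ≤? m + 2)
    ∎
    where
    open ≡-Reasoning
    x = k + k
    dA = suc m ≤? x
    dB = x ≤? suc (suc m)
    dC = m ≤? suc x
    dE = x ≤? m
    eB : suc m + 1 ≡ suc (suc m)
    eB = cong suc (+-comm m 1)
    eC : (suc k + suc k) + 0 ≡ suc (suc x)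
    eC = trans (+-identityʳ _) (double-suc k)

  paths-count : ∀ m a → length (paths m a) ≡ windowSum m a
  paths-count zero a = cong (λ z → 1 * z + 0) (sym (cong₂ _*_ (ind-yes (0 ≤? a) z≤n) (ind-yes (0 ≤? suc a) z≤n)))
  paths-count (suc m) zero = begin
      length (map (U ∷_) (paths m 1))
    ≡⟨ length-map (U ∷_) (paths m 1) ⟩
      length (paths m 1)
    ≡⟨ paths-count m 1 ⟩
      windowSum m 1
    ≡⟨ sumF-cong (suc m) (λ k → cong ((m C k) *_) (sym (inWindow-step₀ m k))) ⟩
      sumF (suc m) (λ k → (m C k) * (inWindow (suc m) 0 k + inWindow (suc m) 0 (suc k)))
    ≡⟨ sym (pascal-sum m (inWindow (suc m) 0)) ⟩
      windowSum (suc m) 0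
    ∎
    where open ≡-Reasoning
  paths-count (suc m) (suc a) = begin
      length (map (U ∷_) (paths m (suc (suc a))) ++ map (D ∷_) (paths m a))
    ≡⟨ length-++ (map (U ∷_) (paths m (suc (suc a)))) ⟩
      length (map (U ∷_) (paths m (suc (suc a)))) + length (map (D ∷_) (paths m a))
    ≡⟨ cong₂ _+_ (trans (length-map (U ∷_) (paths m (suc (suc a)))) (paths-count m (suc (suc a))))
                 (trans (length-map (D ∷_) (paths m a)) (paths-count m a)) ⟩
      windowSum m (suc (suc a)) + windowSum m a
    ≡⟨ sym (sumF-+ (suc m) (λ k → (m C k) * inWindow m (suc (suc a)) k) (λ k → (m C k) * inWindow m a k)) ⟩
      sumF (suc m) (λ k → (m C k) * inWindow m (suc (suc a)) k + (m C k) * inWindow m a k)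
    ≡⟨ sumF-cong (suc m) (λ k → trans (sym (*-distribˡ-+ (m C k) (inWindow m (suc (suc a)) k) (inWindow m a k))) (cong ((m C k) *_) (sym (inWindow-step m a k)))) ⟩
      sumF (suc m) (λ k → (m C k) * (inWindow (suc m) (suc a) k + inWindow (suc m) (suc a) (suc k)))
    ≡⟨ sym (pascal-sum m (inWindow (suc m) (suc a))) ⟩
      windowSum (suc m) (suc a)
    ∎
    where open ≡-Reasoning

  inWindow-centre : ∀ n → inWindow (n + n) 0 n ≡ 1
  inWindow-centre n = cong₂ _*_ (ind-yes (n + n ≤? (n + n) + 0) (≤-reflexive (sym (+-identityʳ _))))
                                (ind-yes ((n + n) ≤? (n + n) + 1) (m≤m+n (n + n) 1))

  inWindow-off : ∀ n k → k ≢ n → inWindow (n + n) 0 k ≡ 0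
  inWindow-off n k k≢n with <-cmp k n
  ... | tri< k<n _ _ = cong (_* ind ((k + k) ≤? (n + n) + 1)) (ind-no (n + n ≤? (k + k) + 0)
          λ le → <⇒≱ (+-mono-< k<n k<n) (≤-trans le (≤-reflexive (+-identityʳ _))))
  ... | tri≈ _ k≡n _ = ⊥-elim (k≢n k≡n)
  ... | tri> _ _ n<k = trans (cong (ind (n + n ≤? (k + k) + 0) *_) (ind-no ((k + k) ≤? (n + n) + 1)
          λ le → <⇒≱ (+-mono-≤-< n<k n<k) (≤-trans le (≤-reflexive (+-comm (n + n) 1)))))
          (*-zeroʳ (ind (n + n ≤? (k + k) + 0)))

  sumF-zero : ∀ K (f : ℕ → ℕ) → (∀ k → f k ≡ 0) → sumF K f ≡ 0
  sumF-zero zero f e = refl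
  sumF-zero (suc K) f e = cong₂ _+_ (e 0) (sumF-zero K (λ k → f (suc k)) (λ k → e (suc k)))

  sumF-single : ∀ K n (g : ℕ → ℕ) → n < K → (∀ k → k ≢ n → g k ≡ 0) → sumF K g ≡ g n
  sumF-single (suc K) zero g lt z =
    trans (cong (g 0 +_) (sumF-zero K (λ k → g (suc k)) (λ k → z (suc k) (λ ())))) (+-identityʳ (g 0))
  sumF-single (suc K) (suc n) g lt z =
    trans (cong (_+ sumF K (λ k → g (suc k))) (z 0 (λ ())))
          (sumF-single K n (λ k → g (suc k)) (s≤s⁻¹ lt) (λ k ne → z (suc k) (λ e → ne (suc-injective e))))

  windowSum-central : ∀ n → windowSum (n + n) 0 ≡ (n + n) C n
  windowSum-central n =
    trans (sumF-single (suc (n + n)) n _ (s≤s (m≤m+n n n)) (λ k k≢n → trans (cong (((n + n) C k) *_) (inWindow-off n k k≢n)) (*-zeroʳ ((n + n) C k))))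
          (trans (cong (((n + n) C n) *_) (inWindow-centre n)) (*-identityʳ _))

  dyckList : ℕ → List (List Step)
  dyckList n = paths (2 * n) 0

  dyckList-length : ∀ n → length (dyckList n) ≡ (2 * n) C n
  dyckList-length n = subst (λ m → length (paths m 0) ≡ m C n) (sym (two*n n))
    (trans (paths-count (n + n) 0) (windowSum-central n))


-- Avoidance of T₁ and T₂ as a local condition on each entry.
module Avoidance where

  open import Data.Nat
  open import Data.Nat.Properties
  open import Data.List using (List; []; _∷_; _++_; length; map; foldr; lookup)
  open import Data.List.Properties using (++-assoc)
  open import Data.List.Membership.Propositional using (_∈_)
  open import Data.List.Relation.Unary.Any using (here; there)
  open import Data.List.Relation.Unary.All using (All; []; _∷_)
  import Data.List.Relation.Unary.All as All
  open import Data.List.Relation.Unary.AllPairs using ([]; _∷_)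
  open import Data.List.Relation.Unary.Unique.Propositional using (Unique)
  open import Data.List.Relation.Binary.Sublist.Propositional using (_⊆_; []; _∷_; _∷ʳ_)
  open import Data.List.Relation.Binary.Sublist.Propositional.Properties using (All-resp-⊆)
  open import Data.Fin using (Fin; zero; suc)
  open import Data.Product using (Σ; _×_; _,_; proj₁; proj₂)
  open import Data.Sum using (_⊎_; inj₁; inj₂)
  open import Data.Empty using (⊥; ⊥-elim)
  open import Data.Unit using (⊤; tt)
  open import Relation.Nullary using (¬_)
  open import Relation.Binary.PropositionalEquality
  open import Relation.Binary.Definitions using (tri<; tri≈; tri>)
  open import Function.Bundles using (_⇔_; mk⇔; Equivalence)

  data Kind : Set where
    k1 k2 : Kind

  Tset : Kind → List (List ℕ)
  Tset k1 = T₁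
  Tset k2 = T₂

  Straddles : ℕ → ℕ → ℕ → Set
  Straddles x c d = (c < x × x < d) ⊎ (d < x × x < c)

  -- The four patterns of T₁ together say "b < a and b lies between
  -- c and d"; those of T₂ say "b is the smallest and c or d is below a".
  Pat : Kind → ℕ → ℕ → ℕ → ℕ → Set
  Pat k1 a b c d = b < a × Straddles b c d
  Pat k2 a b c d = b < a × b < c × b < d × (c < a ⊎ d < a)

  -- Loc K mx x β : the constraint on the entries β after an entry x that is
  -- preceded by a larger entry, the largest such being mx.
  Loc : Kind → ℕ → ℕ → List ℕ → Set
  Loc k1 mx x β = ∀ c d → (c ∷ d ∷ []) ⊆ β → ¬ Straddles x c d
  Loc k2 mx x β = ∀ c d → (c ∷ d ∷ []) ⊆ β → x < c → x < d → mx ≤ c × mx ≤ d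

  -- Good K mx σ : every entry of σ that is not a left-to-right maximum
  -- (given that the entries before σ have maximum mx) satisfies Loc.
  Good : Kind → ℕ → List ℕ → Set
  Good K mx [] = ⊤
  Good K mx (x ∷ β) = (x < mx → Loc K mx x β) × Good K (mx ⊔ x) β

  NoPat : Kind → List ℕ → Set
  NoPat K σ = ∀ a b c d → (a ∷ b ∷ c ∷ d ∷ []) ⊆ σ → ¬ Pat K a b c d

  patFst : ∀ K {a b c d} → Pat K a b c d → b < a
  patFst k1 p = proj₁ p
  patFst k2 p = proj₁ p

  locPat : ∀ K {mx x β a c d} → Loc K mx x β → (c ∷ d ∷ []) ⊆ β → a ≤ mx → Pat K a x c d → ⊥
  locPat k1 l s le (_ , st) = l _ _ s st
  locPat k2 l s le (_ , xc , xd , inj₁ ca) = <-irrefl refl (<-≤-trans ca (≤-trans le (proj₁ (l _ _ s xc xd))))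
  locPat k2 l s le (_ , xc , xd , inj₂ da) = <-irrefl refl (<-≤-trans da (≤-trans le (proj₂ (l _ _ s xc xd))))

  -- An occurrence whose first entry lies before σ (and is ≤ mx) is excluded
  -- by the Loc condition at its second entry.
  good-noPat-tail : ∀ K {mx σ a b c d} → Good K mx σ → (b ∷ c ∷ d ∷ []) ⊆ σ → a ≤ mx → ¬ Pat K a b c d
  good-noPat-tail K {mx} (_ , g) (y ∷ʳ s) le p = good-noPat-tail K g s (≤-trans le (m≤m⊔n mx y)) p
  good-noPat-tail K (l , g) (refl ∷ s) le p = locPat K (l (<-≤-trans (patFst K p) le)) s le p

  good-noPat : ∀ K {mx σ a b c d} → Good K mx σ → (a ∷ b ∷ c ∷ d ∷ []) ⊆ σ → ¬ Pat K a b c d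
  good-noPat K (_ , g) (y ∷ʳ s) p = good-noPat K g s p
  good-noPat K {mx} (_ , g) (refl ∷ s) p = good-noPat-tail K g s (m≤n⊔m mx _) p

  good⇒noPat : ∀ K {σ} → Good K 0 σ → NoPat K σ
  good⇒noPat K g a b c d s p = good-noPat K g s p

  so-len4 : ∀ {s τ} → SameOrder s τ → length τ ≡ 4 → Σ ℕ λ a → Σ ℕ λ b → Σ ℕ λ c → Σ ℕ λ d → s ≡ a ∷ b ∷ c ∷ d ∷ []
  so-len4 {a ∷ b ∷ c ∷ d ∷ []} (e , _) _ = a , b , c , d , refl
  so-len4 {[]} (e , _) l with trans e l
  ... | ()
  so-len4 {_ ∷ []} (e , _) l with trans e l
  ... | ()
  so-len4 {_ ∷ _ ∷ []} (e , _) l with trans e l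
  ... | ()
  so-len4 {_ ∷ _ ∷ _ ∷ []} (e , _) l with trans e l
  ... | ()
  so-len4 {_ ∷ _ ∷ _ ∷ _ ∷ _ ∷ _} (e , _) l with trans e l
  ... | ()

  soRel : ∀ {a b c d τ} → (so : SameOrder (a ∷ b ∷ c ∷ d ∷ []) τ) → (i j : Fin 4) →
    lookup τ (Data.Fin.cast (proj₁ so) i) < lookup τ (Data.Fin.cast (proj₁ so) j) →
    lookup (a ∷ b ∷ c ∷ d ∷ []) i < lookup (a ∷ b ∷ c ∷ d ∷ []) j
  soRel (e , f) i j p = Equivalence.from (f i j) p

  lenT : ∀ K {τ} → τ ∈ Tset K → length τ ≡ 4
  lenT k1 (here refl) = refl
  lenT k1 (there (here refl)) = refl
  lenT k1 (there (there (here refl))) = refl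
  lenT k1 (there (there (there (here refl)))) = refl
  lenT k2 (here refl) = refl
  lenT k2 (there (here refl)) = refl
  lenT k2 (there (there (here refl))) = refl
  lenT k2 (there (there (there (here refl)))) = refl

  contains⇒pat : ∀ K {σ τ} → τ ∈ Tset K → Contains σ τ →
    Σ ℕ λ a → Σ ℕ λ b → Σ ℕ λ c → Σ ℕ λ d → (a ∷ b ∷ c ∷ d ∷ []) ⊆ σ × Pat K a b c d
  contains⇒pat K {σ} {τ} τin (s , ss , so) with so-len4 {s} {τ} so (lenT K τin)
  ... | a , b , c , d , refl = a , b , c , d , ss , pat K τin so
    where
    i0 i1 i2 i3 : Fin 4
    i0 = zero
    i1 = suc zero
    i2 = suc (suc zero)
    i3 = suc (suc (suc zero))
    pat : ∀ K {τ} → τ ∈ Tset K → SameOrder (a ∷ b ∷ c ∷ d ∷ []) τ → Pat K a b c d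
    pat k1 (here refl) so = soRel so i1 i0 (s≤s (s≤s (s≤s z≤n))) , inj₁ (soRel so i2 i1 (s≤s (s≤s z≤n)) , soRel so i1 i3 (s≤s (s≤s (s≤s z≤n))))
    pat k1 (there (here refl)) so = soRel so i1 i0 (s≤s (s≤s (s≤s z≤n))) , inj₂ (soRel so i3 i1 (s≤s (s≤s z≤n)) , soRel so i1 i2 (s≤s (s≤s (s≤s z≤n))))
    pat k1 (there (there (here refl))) so = soRel so i1 i0 (s≤s (s≤s (s≤s z≤n))) , inj₁ (soRel so i2 i1 (s≤s (s≤s z≤n)) , soRel so i1 i3 (s≤s (s≤s (s≤s z≤n))))
    pat k1 (there (there (there (here refl)))) so = soRel so i1 i0 (s≤s (s≤s (s≤s z≤n))) , inj₂ (soRel so i3 i1 (s≤s (s≤s z≤n)) , soRel so i1 i2 (s≤s (s≤s (s≤s z≤n))))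
    pat k2 (here refl) so = soRel so i1 i0 (s≤s (s≤s z≤n)) , soRel so i1 i2 (s≤s (s≤s z≤n)) , soRel so i1 i3 (s≤s (s≤s z≤n)) , inj₁ (soRel so i2 i0 (s≤s (s≤s (s≤s z≤n))))
    pat k2 (there (here refl)) so = soRel so i1 i0 (s≤s (s≤s z≤n)) , soRel so i1 i2 (s≤s (s≤s z≤n)) , soRel so i1 i3 (s≤s (s≤s z≤n)) , inj₂ (soRel so i3 i0 (s≤s (s≤s (s≤s z≤n))))
    pat k2 (there (there (here refl))) so = soRel so i1 i0 (s≤s (s≤s z≤n)) , soRel so i1 i2 (s≤s (s≤s z≤n)) , soRel so i1 i3 (s≤s (s≤s z≤n)) , inj₁ (soRel so i2 i0 (s≤s (s≤s (s≤s z≤n))))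
    pat k2 (there (there (there (here refl)))) so = soRel so i1 i0 (s≤s (s≤s z≤n)) , soRel so i1 i2 (s≤s (s≤s z≤n)) , soRel so i1 i3 (s≤s (s≤s z≤n)) , inj₂ (soRel so i3 i0 (s≤s (s≤s (s≤s z≤n))))

  noPat⇒avoids : ∀ K {σ} → NoPat K σ → Avoids (Tset K) σ
  noPat⇒avoids K np = All.tabulate λ τ∈ contains →
    let (a , b , c , d , sub , occurrence) = contains⇒pat K τ∈ contains in np a b c d sub occurrence

  good⇒avoids : ∀ K {σ} → Good K 0 σ → Avoids (Tset K) σ
  good⇒avoids K g = noPat⇒avoids K (good⇒noPat K g)

  uniqSub : ∀ {xs ys : List ℕ} → Unique ys → xs ⊆ ys → Unique xs
  uniqSub u [] = []
  uniqSub (_ ∷ u) (y ∷ʳ s) = uniqSub u s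
  uniqSub (a ∷ u) (refl ∷ s) = All-resp-⊆ s a ∷ uniqSub u s

  -- embed4 v₁ v₂ v₃ v₄ sends 1, 2, 3, 4 to v₁ < v₂ < v₃ < v₄ (and is strictly
  -- increasing on positive numbers); it maps a pattern τ onto an occurrence
  -- whose entries are ordered like v₁ < ⋯ < v₄, proving SameOrder.
  embed4 : ℕ → ℕ → ℕ → ℕ → ℕ → ℕ
  embed4 v1 v2 v3 v4 zero = 0
  embed4 v1 v2 v3 v4 (suc zero) = v1
  embed4 v1 v2 v3 v4 (suc (suc zero)) = v2
  embed4 v1 v2 v3 v4 (suc (suc (suc zero))) = v3
  embed4 v1 v2 v3 v4 (suc (suc (suc (suc zero)))) = v4
  embed4 v1 v2 v3 v4 (suc (suc (suc (suc (suc k))))) = v4 + suc k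

  module _ {v1 v2 v3 v4 : ℕ} (l12 : v1 < v2) (l23 : v2 < v3) (l34 : v3 < v4) where
    private
      f = embed4 v1 v2 v3 v4
      l13 = <-trans l12 l23
      l24 = <-trans l23 l34
      l14 = <-trans l12 l24
      up4 : ∀ k → v4 ≤ f (suc (suc (suc (suc k))))
      up4 zero = ≤-refl
      up4 (suc k) = m≤m+n v4 (suc k)

    embed4-mono : ∀ x y → 0 < x → x < y → f x < f y
    embed4-mono (suc zero) (suc (suc zero)) _ _ = l12
    embed4-mono (suc zero) (suc (suc (suc zero))) _ _ = l13
    embed4-mono (suc zero) (suc (suc (suc (suc k)))) _ _ = <-≤-trans l14 (up4 k)
    embed4-mono (suc (suc zero)) (suc (suc (suc zero))) _ _ = l23
    embed4-mono (suc (suc zero)) (suc (suc (suc (suc k)))) _ _ = <-≤-trans l24 (up4 k)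
    embed4-mono (suc (suc (suc zero))) (suc (suc (suc (suc k)))) _ _ = <-≤-trans l34 (up4 k)
    embed4-mono (suc (suc (suc (suc zero)))) (suc (suc (suc (suc (suc k))))) _ _ = m<m+n v4 (s≤s z≤n)
    embed4-mono (suc (suc (suc (suc (suc j))))) (suc (suc (suc (suc (suc k))))) _ (s≤s (s≤s (s≤s (s≤s lt)))) =
      +-monoʳ-< v4 lt
    embed4-mono (suc zero) (suc zero) _ (s≤s ())
    embed4-mono (suc (suc zero)) (suc zero) _ (s≤s ())
    embed4-mono (suc (suc zero)) (suc (suc zero)) _ (s≤s (s≤s ()))
    embed4-mono (suc (suc (suc zero))) (suc zero) _ (s≤s ())
    embed4-mono (suc (suc (suc zero))) (suc (suc zero)) _ (s≤s (s≤s ()))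
    embed4-mono (suc (suc (suc zero))) (suc (suc (suc zero))) _ (s≤s (s≤s (s≤s ())))
    embed4-mono (suc (suc (suc (suc j)))) (suc zero) _ (s≤s ())
    embed4-mono (suc (suc (suc (suc j)))) (suc (suc zero)) _ (s≤s (s≤s ()))
    embed4-mono (suc (suc (suc (suc j)))) (suc (suc (suc zero))) _ (s≤s (s≤s (s≤s ())))
    embed4-mono (suc (suc (suc (suc zero)))) (suc (suc (suc (suc zero)))) _ (s≤s (s≤s (s≤s (s≤s ()))))
    embed4-mono (suc (suc (suc (suc (suc j))))) (suc (suc (suc (suc zero)))) _ (s≤s (s≤s (s≤s (s≤s ()))))

    embed4-iff : ∀ x y → 0 < x → 0 < y → (f x < f y ⇔ x < y)
    embed4-iff x y px py = mk⇔ to (embed4-mono x y px)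
      where
      to : f x < f y → x < y
      to h with <-cmp x y
      ... | tri< l _ _ = l
      ... | tri≈ _ refl _ = ⊥-elim (<-irrefl refl h)
      ... | tri> _ _ g = ⊥-elim (<-asym h (embed4-mono y x py g))

    embed4-sameOrder : ∀ t1 t2 t3 t4 → 0 < t1 → 0 < t2 → 0 < t3 → 0 < t4 →
      SameOrder (map f (t1 ∷ t2 ∷ t3 ∷ t4 ∷ [])) (t1 ∷ t2 ∷ t3 ∷ t4 ∷ [])
    embed4-sameOrder t1 t2 t3 t4 p1 p2 p3 p4 = refl , λ where
      zero zero → embed4-iff t1 t1 p1 p1
      zero (suc zero) → embed4-iff t1 t2 p1 p2
      zero (suc (suc zero)) → embed4-iff t1 t3 p1 p3
      zero (suc (suc (suc zero))) → embed4-iff t1 t4 p1 p4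
      (suc zero) zero → embed4-iff t2 t1 p2 p1
      (suc zero) (suc zero) → embed4-iff t2 t2 p2 p2
      (suc zero) (suc (suc zero)) → embed4-iff t2 t3 p2 p3
      (suc zero) (suc (suc (suc zero))) → embed4-iff t2 t4 p2 p4
      (suc (suc zero)) zero → embed4-iff t3 t1 p3 p1
      (suc (suc zero)) (suc zero) → embed4-iff t3 t2 p3 p2
      (suc (suc zero)) (suc (suc zero)) → embed4-iff t3 t3 p3 p3
      (suc (suc zero)) (suc (suc (suc zero))) → embed4-iff t3 t4 p3 p4
      (suc (suc (suc zero))) zero → embed4-iff t4 t1 p4 p1
      (suc (suc (suc zero))) (suc zero) → embed4-iff t4 t2 p4 p2
      (suc (suc (suc zero))) (suc (suc zero)) → embed4-iff t4 t3 p4 p3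
      (suc (suc (suc zero))) (suc (suc (suc zero))) → embed4-iff t4 t4 p4 p4

  -- Conversely, an occurrence of Pat gives, after sorting its four distinct
  -- entries, a subsequence order-isomorphic to one of the patterns.
  pos : ∀ {n} → 0 < suc n
  pos = s≤s z≤n

  avoids⇒noPat : ∀ K {σ} → Unique σ → Avoids (Tset K) σ → NoPat K σ
  avoids⇒noPat K {σ} u av a b c d s p = go K av p
    where
    ud = uniqSub u s
    a≢c : a ≢ c
    a≢c with ud
    ... | (_ ∷ x ∷ _ ∷ []) ∷ _ = x
    a≢d : a ≢ d
    a≢d with ud
    ... | (_ ∷ _ ∷ x ∷ []) ∷ _ = x
    c≢d : c ≢ d
    c≢d with ud
    ... | _ ∷ _ ∷ (x ∷ []) ∷ _ = x
    go : ∀ K → Avoids (Tset K) σ → Pat K a b c d → ⊥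
    go k1 (q1 ∷ q2 ∷ q3 ∷ q4 ∷ []) (ba , inj₁ (cb , bd)) with <-cmp a d
    ... | tri< ad _ _ = q1 (_ , s , embed4-sameOrder cb ba ad 3 2 1 4 pos pos pos pos)
    ... | tri≈ _ e _ = a≢d e
    ... | tri> _ _ da = q3 (_ , s , embed4-sameOrder cb bd da 4 2 1 3 pos pos pos pos)
    go k1 (q1 ∷ q2 ∷ q3 ∷ q4 ∷ []) (ba , inj₂ (db , bc)) with <-cmp a c
    ... | tri< ac _ _ = q2 (_ , s , embed4-sameOrder db ba ac 3 2 4 1 pos pos pos pos)
    ... | tri≈ _ e _ = a≢c e
    ... | tri> _ _ ca = q4 (_ , s , embed4-sameOrder db bc ca 4 2 3 1 pos pos pos pos)
    go k2 (q1 ∷ q2 ∷ q3 ∷ q4 ∷ []) (ba , bc , bd , cda) with <-cmp c d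
    ... | tri≈ _ e _ = c≢d e
    ... | tri< cd _ _ with <-cmp a d
    ...   | tri≈ _ e _ = a≢d e
    ...   | tri> _ _ da = q3 (_ , s , embed4-sameOrder bc cd da 4 1 2 3 pos pos pos pos)
    ...   | tri< ad _ _ with cda
    ...     | inj₂ da = <-asym ad da
    ...     | inj₁ ca = q1 (_ , s , embed4-sameOrder bc ca ad 3 1 2 4 pos pos pos pos)
    go k2 (q1 ∷ q2 ∷ q3 ∷ q4 ∷ []) (ba , bc , bd , cda) | tri> _ _ dc with <-cmp a c
    ...   | tri≈ _ e _ = a≢c e
    ...   | tri> _ _ ca = q4 (_ , s , embed4-sameOrder bd dc ca 4 1 3 2 pos pos pos pos)
    ...   | tri< ac _ _ with cda
    ...     | inj₁ ca = <-asym ac ca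
    ...     | inj₂ da = q2 (_ , s , embed4-sameOrder bd da ac 3 1 4 2 pos pos pos pos)

  maxL : List ℕ → ℕ
  maxL = foldr _⊔_ 0

  maxL-∈ : ∀ pre → 0 < maxL pre → maxL pre ∈ pre
  maxL-∈ (x ∷ xs) p with ⊔-sel x (maxL xs)
  ... | inj₁ e = subst (_∈ x ∷ xs) (sym e) (here refl)
  ... | inj₂ e = subst (_∈ x ∷ xs) (sym e) (there (maxL-∈ xs (subst (0 <_) e p)))

  maxL-snoc : ∀ pre x → maxL (pre ++ x ∷ []) ≡ maxL pre ⊔ x
  maxL-snoc [] x = ⊔-identityʳ x
  maxL-snoc (y ∷ pre) x = trans (cong (y ⊔_) (maxL-snoc pre x)) (sym (⊔-assoc y (maxL pre) x))

  skipAll : ∀ (pre : List ℕ) {zs ws} → zs ⊆ ws → zs ⊆ pre ++ ws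
  skipAll [] s = s
  skipAll (y ∷ pre) s = y ∷ʳ skipAll pre s

  mkSub : ∀ {a x ys β} pre → a ∈ pre → ys ⊆ β → (a ∷ x ∷ ys) ⊆ pre ++ x ∷ β
  mkSub (_ ∷ pre) (here refl) s = refl ∷ skipAll pre (refl ∷ s)
  mkSub (y ∷ pre) (there ai) s = y ∷ʳ mkSub pre ai s

  -- Avoidance in pre ++ σ gives the local condition on σ relative to max pre:
  -- a violation of Loc at x, together with the maximum of the prefix, is an
  -- occurrence of Pat.
  noPat⇒good : ∀ K pre σ → NoPat K (pre ++ σ) → Good K (maxL pre) σ
  noPat⇒good K pre [] np = tt
  noPat⇒good K pre (x ∷ β) np = loc K np , rest
    where
    aIn : x < maxL pre → maxL pre ∈ pre
    aIn lt = maxL-∈ pre (≤-<-trans z≤n lt)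
    loc : ∀ K → NoPat K (pre ++ x ∷ β) → x < maxL pre → Loc K (maxL pre) x β
    loc k1 np lt c d s st = np _ x c d (mkSub pre (aIn lt) s) (lt , st)
    loc k2 np lt c d s xc xd = ≮⇒≥ (λ cm → np _ x c d (mkSub pre (aIn lt) s) (lt , xc , xd , inj₁ cm)) ,
                               ≮⇒≥ (λ dm → np _ x c d (mkSub pre (aIn lt) s) (lt , xc , xd , inj₂ dm))
    rest : Good K (maxL pre ⊔ x) β
    rest = subst (λ z → Good K z β) (maxL-snoc pre x)
      (noPat⇒good K (pre ++ x ∷ []) β (subst (NoPat K) (sym (++-assoc pre (x ∷ []) β)) np))

  avoids⇒good : ∀ K {σ} → Unique σ → Avoids (Tset K) σ → Good K 0 σ
  avoids⇒good K u av = noPat⇒good K [] _ (avoids⇒noPat K u av)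


-- Permutations of {1..m}, described by their values instead of by ↭.
module Permutations where

  open import Data.Nat
  open import Data.Nat.Properties
  open import Data.List using (List; map; upTo)
  open import Data.List.Membership.Propositional using (_∈_)
  open import Data.List.Membership.Propositional.Properties using (∈-map⁺; ∈-map⁻; ∈-upTo⁺; ∈-upTo⁻)
  open import Data.List.Relation.Unary.Unique.Propositional using (Unique)
  import Data.List.Relation.Unary.Unique.Propositional.Properties as UP
  open import Data.List.Relation.Binary.Permutation.Propositional using (↭-sym; ↭⇒↭ₛ)
  open import Data.List.Relation.Binary.Permutation.Propositional.Properties using (∈-resp-↭)
  import Data.List.Relation.Binary.Permutation.Setoid.Properties as PSP
  open import Data.List.Membership.Propositional.Properties.WithK using (unique∧set⇒bag)
  open import Data.List.Relation.Binary.BagAndSetEquality using (∼bag⇒↭)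
  open import Data.Product using (_×_; _,_)
  open import Relation.Binary.PropositionalEquality
  open import Function.Bundles using (_⇔_; mk⇔; Equivalence)

  PermSpec : ℕ → List ℕ → Set
  PermSpec m σ = Unique σ × (∀ v → v ∈ σ ⇔ (0 < v × v ≤ m))

  range-∈ : ∀ m v → v ∈ map suc (upTo m) ⇔ (0 < v × v ≤ m)
  range-∈ m v = mk⇔ to from
    where
    to : v ∈ map suc (upTo m) → 0 < v × v ≤ m
    to p with ∈-map⁻ suc p
    ... | i , ip , refl = s≤s z≤n , ∈-upTo⁻ ip
    from : 0 < v × v ≤ m → v ∈ map suc (upTo m)
    from (s≤s {n = i} z≤n , le) = ∈-map⁺ suc (∈-upTo⁺ le)

  range-unique : ∀ m → Unique (map suc (upTo m))
  range-unique m = UP.map⁺ suc-injective (UP.upTo⁺ m)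

  -- IsPerm m σ ⇔ PermSpec m σ; the converse direction uses that two
  -- duplicate-free lists with the same elements are permutations of each other.
  perm⇒ : ∀ {m σ} → IsPerm m σ → PermSpec m σ
  perm⇒ {m} {σ} p =
    PSP.Unique-resp-↭ (setoid ℕ) (↭⇒↭ₛ (↭-sym p)) (range-unique m) ,
    λ v → mk⇔ (λ vin → Equivalence.to (range-∈ m v) (∈-resp-↭ p vin))
              (λ c → ∈-resp-↭ (↭-sym p) (Equivalence.from (range-∈ m v) c))

  perm⇐ : ∀ {m σ} → PermSpec m σ → IsPerm m σ
  perm⇐ {m} {σ} (u , f) = ∼bag⇒↭ (unique∧set⇒bag u (range-unique m)
    (λ {v} → mk⇔ (λ vin → Equivalence.from (range-∈ m v) (Equivalence.to (f v) vin))
                 (λ vin → Equivalence.from (f v) (Equivalence.to (range-∈ m v) vin))))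


-- It reads a Dyck prefix from left to right, keeping the set
-- of values not yet used.  A run of U's after the left-to-right maximum m
-- announces the next maximum m + r; the D's following a maximum stand for the
-- entries of its word w_i, and an entry of w_i is forced by avoidance: for T₁
-- it is the smallest unused value, for T₂ the largest unused value below the
-- current maximum.  Once the maximum N is reached the rest of the path is the
-- Q-word of w_k, decoded similarly.
module Decoder where

  open Avoidance using (Kind; k1; k2)
  open import Data.Nat
  open import Data.Nat.Properties
  open import Data.Bool using (Bool; true; false; _∧_; not; if_then_else_)
  open import Data.Bool.Properties using (∧-identityʳ; ∧-zeroʳ; T-≡; T-∧)
  open import Data.List using (List; []; _∷_)
  open import Data.Product using (_×_; _,_)
  open import Data.Sum using (inj₁; inj₂)
  open import Data.Empty using (⊥; ⊥-elim)
  open import Relation.Nullary using (yes; no)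
  open import Relation.Binary.PropositionalEquality
  open import Function.Bundles using (Equivalence)

  Avail : Set
  Avail = ℕ → Bool

  remove : Avail → ℕ → Avail
  remove av v u = av u ∧ not (u ≡ᵇ v)

  -- the largest available value in 1..k (0 if there is none)
  topBelow : Avail → ℕ → ℕ
  topBelow av zero = 0
  topBelow av (suc k) = if av (suc k) then suc k else topBelow av k

  -- pick r b x : keep an earlier hit r > 0, otherwise take x if b holds
  pick : ℕ → Bool → ℕ → ℕ
  pick zero true x = x
  pick zero false x = 0
  pick (suc r) _ x = suc r

  -- the smallest available value in 1..k (0 if there is none)
  minS : Avail → ℕ → ℕ
  minS av zero = 0
  minS av (suc k) = pick (minS av k) (av (suc k)) (suc k)

  cnt : Avail → ℕ → ℕ
  cnt av zero = 0
  cnt av (suc k) = if av (suc k) then suc (cnt av k) else cnt av k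

  _≐_ : Avail → Avail → Set
  f ≐ g = ∀ u → f u ≡ g u

  remove-ext : ∀ {f g} v → f ≐ g → remove f v ≐ remove g v
  remove-ext v e u = cong (_∧ not (u ≡ᵇ v)) (e u)

  topBelow-ext : ∀ {f g} k → f ≐ g → topBelow f k ≡ topBelow g k
  topBelow-ext zero e = refl
  topBelow-ext (suc k) e rewrite e (suc k) | topBelow-ext k e = refl

  minS-ext : ∀ {f g} k → f ≐ g → minS f k ≡ minS g k
  minS-ext zero e = refl
  minS-ext (suc k) e rewrite e (suc k) | minS-ext k e = refl

  cnt-ext : ∀ {f g} k → f ≐ g → cnt f k ≡ cnt g k
  cnt-ext zero e = refl
  cnt-ext (suc k) e rewrite e (suc k) | cnt-ext k e = refl

  -- the value decoded from a D inside the word of the maximum M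
  chooseW : Kind → Avail → ℕ → ℕ
  chooseW k1 av M = minS av M
  chooseW k2 av M = topBelow av (M ∸ 1)

  -- the value decoded from a D in the Q-word of the last block
  chooseD : Kind → ℕ → Avail → ℕ
  chooseD k1 N av = minS av N
  chooseD k2 N av = topBelow av (topBelow av N ∸ 1)

  chooseW-ext : ∀ K {f g} M → f ≐ g → chooseW K f M ≡ chooseW K g M
  chooseW-ext k1 M e = minS-ext M e
  chooseW-ext k2 M e = topBelow-ext (M ∸ 1) e

  chooseD-ext : ∀ K N {f g} → f ≐ g → chooseD K N f ≡ chooseD K N g
  chooseD-ext k1 N e = minS-ext N e
  chooseD-ext k2 N {f} {g} e rewrite topBelow-ext N e = topBelow-ext (topBelow g N ∸ 1) e

  -- decW m av q : decode q after the left-to-right maximum m;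
  -- decU m r av q : r U's have been read since the maximum m;
  -- decL av q : decode the Q-word of the last block (after N).
  module Dc (K : Kind) (N : ℕ) where
    mutual
      decW : ℕ → Avail → List Step → List ℕ
      decW m av [] = N ∷ []
      decW m av (U ∷ q) = decU m 1 av q
      decW m av (D ∷ q) = chooseW K av m ∷ decW m (remove av (chooseW K av m)) q

      decU : ℕ → ℕ → Avail → List Step → List ℕ
      decU m r av q = decU' (m + r ≡ᵇ N) m r av q

      decU' : Bool → ℕ → ℕ → Avail → List Step → List ℕ
      decU' true m r av q = N ∷ decL (remove av N) q
      decU' false m r av [] = N ∷ []
      decU' false m r av (U ∷ q) = decU m (suc r) av q
      decU' false m r av (D ∷ q) = (m + r) ∷ decW (m + r) (remove av (m + r)) q

      decL : Avail → List Step → List ℕ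
      decL av [] = topBelow av N ∷ []
      decL av (U ∷ q) = topBelow av N ∷ decL (remove av (topBelow av N)) q
      decL av (D ∷ q) = chooseD K N av ∷ decL (remove av (chooseD K N av)) q

    mutual
      decW-ext : ∀ {f g} m q → f ≐ g → decW m f q ≡ decW m g q
      decW-ext m [] e = refl
      decW-ext m (U ∷ q) e = decU-ext m 1 q e
      decW-ext m (D ∷ q) e rewrite chooseW-ext K m e =
        cong (_ ∷_) (decW-ext m q (remove-ext _ e))

      decU-ext : ∀ {f g} m r q → f ≐ g → decU m r f q ≡ decU m r g q
      decU-ext m r q e = decU'-ext (m + r ≡ᵇ N) m r q e

      decU'-ext : ∀ {f g} b m r q → f ≐ g → decU' b m r f q ≡ decU' b m r g q
      decU'-ext true m r q e = cong (N ∷_) (decL-ext q (remove-ext N e))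
      decU'-ext false m r [] e = refl
      decU'-ext false m r (U ∷ q) e = decU-ext m (suc r) q e
      decU'-ext false m r (D ∷ q) e = cong ((m + r) ∷_) (decW-ext (m + r) q (remove-ext (m + r) e))

      decL-ext : ∀ {f g} q → f ≐ g → decL f q ≡ decL g q
      decL-ext [] e = cong (_∷ []) (topBelow-ext N e)
      decL-ext (U ∷ q) e rewrite topBelow-ext N e = cong (_ ∷_) (decL-ext q (remove-ext _ e))
      decL-ext (D ∷ q) e rewrite chooseD-ext K N e = cong (_ ∷_) (decL-ext q (remove-ext _ e))

  range : ℕ → Avail
  range N u = (0 <ᵇ u) ∧ (u ≤ᵇ N)

  range-sound : ∀ N u → range N u ≡ true → 0 < u × u ≤ N
  range-sound N u e with Equivalence.to T-∧ (Equivalence.from T-≡ e)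
  ... | pos , bounded = <ᵇ⇒< 0 u pos , ≤ᵇ⇒≤ u N bounded

  range-complete : ∀ N u → 0 < u → u ≤ N → range N u ≡ true
  range-complete N u pos bounded = Equivalence.to T-≡ (Equivalence.from T-∧ (<⇒<ᵇ pos , ≤⇒≤ᵇ bounded))

  ψ : Kind → ℕ → List Step → List ℕ
  ψ K N = Dc.decW K N 0 (range N)

  ≡ᵇ-refl : ∀ n → (n ≡ᵇ n) ≡ true
  ≡ᵇ-refl zero = refl
  ≡ᵇ-refl (suc n) = ≡ᵇ-refl n

  ≡ᵇ-true : ∀ {a b} → a ≡ b → (a ≡ᵇ b) ≡ true
  ≡ᵇ-true {a} refl = ≡ᵇ-refl a

  ≡ᵇ-true⇒≡ : ∀ a b → (a ≡ᵇ b) ≡ true → a ≡ b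
  ≡ᵇ-true⇒≡ a b e = ≡ᵇ⇒≡ a b (subst Data.Bool.T (sym e) _)

  ≡ᵇ-≢ : ∀ m n → m ≢ n → (m ≡ᵇ n) ≡ false
  ≡ᵇ-≢ zero zero ne = ⊥-elim (ne refl)
  ≡ᵇ-≢ zero (suc n) ne = refl
  ≡ᵇ-≢ (suc m) zero ne = refl
  ≡ᵇ-≢ (suc m) (suc n) ne = ≡ᵇ-≢ m n (λ e → ne (cong suc e))

  true≢false : true ≢ false
  true≢false ()

  ≡ᵇ-false⇒≢ : ∀ a b → (a ≡ᵇ b) ≡ false → a ≢ b
  ≡ᵇ-false⇒≢ a b e refl = true≢false (trans (sym (≡ᵇ-refl a)) e)

  remove-self : ∀ av v → remove av v v ≡ false
  remove-self av v rewrite ≡ᵇ-refl v = ∧-zeroʳ (av v)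

  remove-other : ∀ av v u → u ≢ v → remove av v u ≡ av u
  remove-other av v u ne rewrite ≡ᵇ-≢ u v ne = ∧-identityʳ (av u)

  remove-true : ∀ av v u → remove av v u ≡ true → av u ≡ true × u ≢ v
  remove-true av v u e with u ≟ v
  ... | yes refl = ⊥-elim (true≢false (trans (sym e) (remove-self av v)))
  ... | no ne = trans (sym (remove-other av v u ne)) e , ne

  cnt-zero : ∀ av k → cnt av k ≡ 0 → ∀ u → 0 < u → u ≤ k → av u ≡ false
  cnt-zero av zero e u pu le = ⊥-elim (<-irrefl refl (<-≤-trans pu le))
  cnt-zero av (suc k) e u pu le with av (suc k) in eq
  ... | true = ⊥-elim (case e)
    where
    case : suc (cnt av k) ≡ 0 → ⊥
    case ()
  ... | false with m≤n⇒m<n∨m≡n le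
  ...   | inj₁ lt = cnt-zero av k e u pu (s≤s⁻¹ lt)
  ...   | inj₂ refl = eq

  ifcong : ∀ {A : Set} {b b' : Bool} {x x' y y' : A} → b ≡ b' → x ≡ x' → y ≡ y' →
    (if b then x else y) ≡ (if b' then x' else y')
  ifcong refl refl refl = refl

  ifsuc : ∀ b {A B : ℕ} → suc A ≡ B → suc (if b then suc A else A) ≡ (if b then suc B else B)
  ifsuc true e = cong suc e
  ifsuc false e = e

  cnt-remove-out : ∀ av v k → k < v → cnt (remove av v) k ≡ cnt av k
  cnt-remove-out av v zero lt = refl
  cnt-remove-out av v (suc k) lt =
    ifcong (remove-other av v (suc k) (λ e → <-irrefl e lt)) (cong suc ih) ih
    where ih = cnt-remove-out av v k (<-trans (n<1+n k) lt)

  cnt-remove-in : ∀ av k v → 0 < v → v ≤ k → av v ≡ true → suc (cnt (remove av v) k) ≡ cnt av k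
  cnt-remove-in av zero v pv le avv = ⊥-elim (<-irrefl refl (<-≤-trans pv le))
  cnt-remove-in av (suc k) v pv le avv with m≤n⇒m<n∨m≡n le
  ... | inj₂ refl = trans (cong suc (ifcong (remove-self av (suc k)) refl (cnt-remove-out av (suc k) k (n<1+n k))))
                          (sym (ifcong avv refl refl))
  ... | inj₁ lt = trans (cong suc (ifcong (remove-other av v (suc k) (λ e → <-irrefl (sym e) lt)) refl refl))
                        (ifsuc (av (suc k)) (cnt-remove-in av k v pv (s≤s⁻¹ lt) avv))

  cnt-run : ∀ av m r → (∀ u → m < u → u ≤ m + r → av u ≡ true) → cnt av (m + r) ≡ cnt av m + r
  cnt-run av m zero f = trans (cong (cnt av) (+-identityʳ m)) (sym (+-identityʳ _))
  cnt-run av m (suc r) f =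
    trans (cong (cnt av) (+-suc m r))
    (trans (ifcong (f (suc (m + r)) (s≤s (m≤m+n m r)) (≤-reflexive (sym (+-suc m r)))) (cong suc ih) ih)
           (sym (+-suc _ r)))
    where ih = cnt-run av m r (λ u lt le → f u lt (≤-trans le (≤-trans (n≤1+n (m + r)) (≤-reflexive (sym (+-suc m r))))))

  record TBspec (av : Avail) (k v : ℕ) : Set where
    constructor mkTB
    field
      tb-pos : 0 < v
      tb-bound : v ≤ k
      tb-avail : av v ≡ true
      tb-top : ∀ u → v < u → u ≤ k → av u ≡ false

  record MSspec (av : Avail) (k v : ℕ) : Set where
    constructor mkMS
    field
      ms-pos : 0 < v
      ms-bound : v ≤ k
      ms-avail : av v ≡ true
      ms-least : ∀ u → 0 < u → u < v → av u ≡ false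

  topBelow-char : ∀ av k v → 0 < v → v ≤ k → av v ≡ true → (∀ u → v < u → u ≤ k → av u ≡ false) → topBelow av k ≡ v
  topBelow-char av zero v pv le avv f = ⊥-elim (<-irrefl refl (<-≤-trans pv le))
  topBelow-char av (suc k) v pv le avv f with m≤n⇒m<n∨m≡n le
  ... | inj₂ refl = ifcong avv refl refl
  ... | inj₁ lt = trans (ifcong (f (suc k) lt ≤-refl) refl refl)
                        (topBelow-char av k v pv (s≤s⁻¹ lt) avv (λ u l1 l2 → f u l1 (≤-trans l2 (n≤1+n k))))

  topBelow-found : ∀ av k → 0 < cnt av k → TBspec av k (topBelow av k)
  topBelow-found av zero ()
  topBelow-found av (suc k) p with av (suc k) in eq
  ... | true = mkTB (s≤s z≤n) ≤-refl eq λ u l1 l2 → ⊥-elim (<-irrefl refl (<-≤-trans l1 l2))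
  ... | false with topBelow-found av k p
  ...   | mkTB a b c d = mkTB a (≤-trans b (n≤1+n k)) c h
    where
    h : ∀ u → topBelow av k < u → u ≤ suc k → av u ≡ false
    h u l1 l2 with m≤n⇒m<n∨m≡n l2
    ... | inj₁ lt = d u l1 (s≤s⁻¹ lt)
    ... | inj₂ refl = eq

  minS-none : ∀ av k → (∀ u → 0 < u → u ≤ k → av u ≡ false) → minS av k ≡ 0
  minS-none av zero f = refl
  minS-none av (suc k) f rewrite minS-none av k (λ u pu le → f u pu (≤-trans le (n≤1+n k))) | f (suc k) (s≤s z≤n) ≤-refl = refl

  pick-pos : ∀ r b x → 0 < r → pick r b x ≡ r
  pick-pos (suc r) b x _ = refl

  minS-char : ∀ av k v → 0 < v → v ≤ k → av v ≡ true → (∀ u → 0 < u → u < v → av u ≡ false) → minS av k ≡ v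
  minS-char av zero v pv le avv f = ⊥-elim (<-irrefl refl (<-≤-trans pv le))
  minS-char av (suc k) v pv le avv f with m≤n⇒m<n∨m≡n le
  ... | inj₂ refl rewrite minS-none av k (λ u pu l → f u pu (s≤s l)) | avv = refl
  ... | inj₁ lt = trans (pick-pos (minS av k) (av (suc k)) (suc k) (subst (0 <_) (sym e) pv)) e
    where e = minS-char av k v pv (s≤s⁻¹ lt) avv f

  minS-found : ∀ av k → 0 < cnt av k → MSspec av k (minS av k)
  minS-found av zero ()
  minS-found av (suc k) p with cnt av k in ek
  ... | suc c with minS-found av k (subst (0 <_) (sym ek) (s≤s z≤n))
  ...   | mkMS a b c' d = subst (MSspec av (suc k)) (sym e2) (mkMS a (≤-trans b (n≤1+n k)) c' d)
    where
    e2 : minS av (suc k) ≡ minS av k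
    e2 = pick-pos (minS av k) (av (suc k)) (suc k) a
  minS-found av (suc k) p | zero with av (suc k) in eq
  ... | false = ⊥-elim (<-irrefl refl p)
  ... | true = subst (MSspec av (suc k)) (sym (cong (λ z → pick z true (suc k)) (minS-none av k (cnt-zero av k ek))))
    (mkMS (s≤s z≤n) ≤-refl eq λ u pu lt → cnt-zero av k ek u pu (s≤s⁻¹ lt))


module DecoderFacts where

  open DyckPaths using (DyckFrom; nil; up; down)
  open Avoidance using (maxL)
  open Decoder
  open import Data.Nat
  open import Data.Nat.Properties
  open import Data.Bool using (Bool; true; false)
  open import Data.List using (List; []; _∷_; _++_; length; replicate; span)
  open import Data.List.Properties using (length-++; ++-identityʳ)
  open import Data.List.Membership.Propositional using (_∈_; _∉_)
  open import Data.List.Membership.DecPropositional _≟_ using (_∈?_)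
  open import Data.List.Relation.Unary.Any using (here; there)
  open import Data.List.Relation.Unary.All using (All; []; _∷_)
  open import Data.List.Relation.Unary.AllPairs using ([]; _∷_)
  open import Data.List.Relation.Unary.Unique.Propositional using (Unique)
  open import Data.List.Relation.Unary.Unique.Propositional.Properties using (Unique[x∷xs]⇒x∉xs)
  open import Data.List.Relation.Binary.Sublist.Propositional using (_⊆_; []; _∷_; _∷ʳ_)
  open import Data.List.Relation.Binary.Sublist.Heterogeneous using (fromAny)
  open import Data.Product using (_×_; _,_; proj₁; proj₂)
  open import Data.Sum using (_⊎_; inj₁; inj₂)
  open import Data.Empty using (⊥-elim)
  open import Relation.Nullary using (¬_; yes; no; does)
  open import Relation.Binary.PropositionalEquality

  -- the availability set of the values occurring in s (kept abstract so
  -- that it is only used through its specification)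
  abstract
    availOf : List ℕ → Avail
    availOf s u = does (u ∈? s)

    availOf-true : ∀ {s u} → u ∈ s → availOf s u ≡ true
    availOf-true {s} {u} p with u ∈? s
    ... | yes _ = refl
    ... | no np = ⊥-elim (np p)

    availOf-false : ∀ {s u} → u ∉ s → availOf s u ≡ false
    availOf-false {s} {u} p with u ∈? s
    ... | yes q = ⊥-elim (p q)
    ... | no _ = refl

    availOf-∈ : ∀ {s u} → availOf s u ≡ true → u ∈ s
    availOf-∈ {s} {u} e with u ∈? s
    ... | yes q = q
    availOf-∈ {s} {u} () | no _

    availOf-[] : ∀ u → availOf [] u ≡ false
    availOf-[] u = refl

  uTail : ∀ {x : ℕ} {xs} → Unique (x ∷ xs) → Unique xs
  uTail (_ ∷ u) = u

  bool-ext : ∀ {a b : Bool} → (a ≡ true → b ≡ true) → (b ≡ true → a ≡ true) → a ≡ b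
  bool-ext {true} {true} f g = refl
  bool-ext {true} {false} f g with f refl
  ... | ()
  bool-ext {false} {true} f g with g refl
  ... | ()
  bool-ext {false} {false} f g = refl

  remove-availOf : ∀ {x xs} → x ∉ xs → remove (availOf (x ∷ xs)) x ≐ availOf xs
  remove-availOf {x} {xs} nin u with u ≟ x
  ... | yes refl = trans (remove-self (availOf (x ∷ xs)) x) (sym (availOf-false {xs} {x} nin))
  ... | no ne = trans (remove-other (availOf (x ∷ xs)) x u ne) h
    where
    h : availOf (x ∷ xs) u ≡ availOf xs u
    h = bool-ext (λ e → availOf-true {xs} {u} (tl (availOf-∈ {x ∷ xs} {u} e))) (λ e → availOf-true {x ∷ xs} {u} (there (availOf-∈ {xs} {u} e)))
      where
      tl : u ∈ x ∷ xs → u ∈ xs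
      tl (here e) = ⊥-elim (ne e)
      tl (there p) = p

  InR : ℕ → ℕ → Set
  InR k v = 0 < v × v ≤ k

  cnt-availOf-++ : ∀ k ys t → Unique (ys ++ t) → All (InR k) ys → cnt (availOf (ys ++ t)) k ≡ length ys + cnt (availOf t) k
  cnt-availOf-++ k [] t u a = refl
  cnt-availOf-++ k (y ∷ ys) t u ((py , yk) ∷ a) =
    trans (sym (cnt-remove-in (availOf (y ∷ ys ++ t)) k y py yk (availOf-true {y ∷ ys ++ t} {y} (here refl))))
          (cong suc (trans (cnt-ext k (remove-availOf (Unique[x∷xs]⇒x∉xs u))) (cnt-availOf-++ k ys t (uTail u) a)))

  cnt-availOf : ∀ k s → Unique s → All (InR k) s → cnt (availOf s) k ≡ length s
  cnt-availOf k s u a = trans (cong (λ z → cnt (availOf z) k) (sym (++-identityʳ s)))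
    (trans (cnt-availOf-++ k s [] (subst Unique (sym (++-identityʳ s)) u) a) (trans (cong (length s +_) (cnt0 k)) (+-identityʳ _)))
    where
    cnt0 : ∀ k → cnt (availOf []) k ≡ 0
    cnt0 zero = refl
    cnt0 (suc k) rewrite availOf-[] (suc k) = cnt0 k

  dyck-Us : ∀ {h} j q → DyckFrom (h + j) q → DyckFrom h (replicate j U ++ q)
  dyck-Us {h} zero q d = subst (λ z → DyckFrom z q) (+-identityʳ h) d
  dyck-Us {h} (suc j) q d = up (dyck-Us j q (subst (λ z → DyckFrom z q) (+-suc h j) d))

  dyck-Ds : ∀ {h} j q → DyckFrom h q → DyckFrom (h + j) (replicate j D ++ q)
  dyck-Ds {h} zero q d = subst (λ z → DyckFrom z q) (sym (+-identityʳ h)) d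
  dyck-Ds {h} (suc j) q d = subst (λ z → DyckFrom z (D ∷ replicate j D ++ q)) (sym (+-suc h j)) (down (dyck-Ds j q d))

  dyck-short : ∀ h q → length q ≤ h → DyckFrom h q
  dyck-short h [] _ = nil
  dyck-short h (U ∷ q) le = up (dyck-short (suc h) q (≤-trans (n≤1+n _) (≤-trans le (n≤1+n h))))
  dyck-short (suc h) (D ∷ q) le = down (dyck-short h q (s≤s⁻¹ le))
  dyck-short zero (D ∷ q) ()

  ltb : ∀ {z x} → (z <ᵇ x) ≡ true → z < x
  ltb {z} {x} e = <ᵇ⇒< z x (subst Data.Bool.T (sym e) _)

  nltb : ∀ {z x} → (z <ᵇ x) ≡ false → ¬ z < x
  nltb {z} {x} e lt with subst Data.Bool.T e (<⇒<ᵇ lt)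
  ... | ()

  SpanR : ℕ → List ℕ → List ℕ → List ℕ → Set
  SpanR x xs w r = xs ≡ w ++ r × All (_< x) w × (∀ y ys → r ≡ y ∷ ys → ¬ y < x)

  span-lemma : ∀ x xs → SpanR x xs (proj₁ (span (λ y → y <? x) xs)) (proj₂ (span (λ y → y <? x) xs))
  span-lemma x [] = refl , [] , λ y ys ()
  span-lemma x (z ∷ xs) with z <ᵇ x in eq
  ... | true with span-lemma x xs
  ...   | (e , a , h) = cong (z ∷_) e , ltb eq ∷ a , h
  span-lemma x (z ∷ xs) | false = refl , [] , λ { y ys refl → nltb eq }

  span-char : ∀ x w r → All (_< x) w → (∀ y ys → r ≡ y ∷ ys → ¬ y < x) → span (λ y → y <? x) (w ++ r) ≡ (w , r)
  span-char x [] [] a h = refl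
  span-char x [] (y ∷ r) a h with y <ᵇ x in eq
  ... | true = ⊥-elim (h y r refl (ltb eq))
  ... | false = refl
  span-char x (z ∷ w) r (lt ∷ a) h with z <ᵇ x in eq
  ... | true rewrite span-char x w r a h = refl
  ... | false = ⊥-elim (nltb eq lt)

  span-len : ∀ x xs → length (proj₂ (span (λ y → y <? x) xs)) ≤ length xs
  span-len x xs with span-lemma x xs
  ... | (e , _ , _) = subst (λ z → length (proj₂ (span (λ y → y <? x) xs)) ≤ length z) (sym e)
     (subst (length (proj₂ (span (λ y → y <? x) xs)) ≤_) (sym (length-++ (proj₁ (span (λ y → y <? x) xs)))) (m≤n+m _ _))

  blocksF-fuel : ∀ f g l → length l ≤ f → length l ≤ g → blocksF f l ≡ blocksF g l
  blocksF-fuel zero zero l _ _ = refl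
  blocksF-fuel zero (suc g) [] _ _ = refl
  blocksF-fuel (suc f) zero [] _ _ = refl
  blocksF-fuel (suc f) (suc g) [] _ _ = refl
  blocksF-fuel (suc f) (suc g) (x ∷ xs) (s≤s lf) (s≤s lg) =
    cong ((x , proj₁ (span (λ y → y <? x) xs)) ∷_)
      (blocksF-fuel f g _ (≤-trans (span-len x xs) lf) (≤-trans (span-len x xs) lg))

  blocks-cons : ∀ x xs → blocks (x ∷ xs) ≡ (x , proj₁ (span (λ y → y <? x) xs)) ∷ blocks (proj₂ (span (λ y → y <? x) xs))
  blocks-cons x xs = cong ((x , proj₁ (span (λ y → y <? x) xs)) ∷_)
    (blocksF-fuel (length xs) _ _ (span-len x xs) ≤-refl)

  pairSub : ∀ {u v : ℕ} {t} → u ∈ t → v ∈ t → u ≢ v → ((u ∷ v ∷ []) ⊆ t) ⊎ ((v ∷ u ∷ []) ⊆ t)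
  pairSub (here refl) (here refl) ne = ⊥-elim (ne refl)
  pairSub (here refl) (there q) ne = inj₁ (refl ∷ fromAny q)
  pairSub (there p) (here refl) ne = inj₂ (refl ∷ fromAny p)
  pairSub {t = y ∷ t} (there p) (there q) ne with pairSub p q ne
  ... | inj₁ s = inj₁ (y ∷ʳ s)
  ... | inj₂ s = inj₂ (y ∷ʳ s)

  maxL-ub : ∀ {v} xs → v ∈ xs → v ≤ maxL xs
  maxL-ub (x ∷ xs) (here refl) = m≤m⊔n x (maxL xs)
  maxL-ub (x ∷ xs) (there p) = ≤-trans (maxL-ub xs p) (m≤n⊔m x (maxL xs))

  maxL-∈′ : ∀ x xs → maxL (x ∷ xs) ∈ (x ∷ xs)
  maxL-∈′ x [] = subst (_∈ x ∷ []) (sym (⊔-identityʳ x)) (here refl)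
  maxL-∈′ x (y ∷ ys) with ⊔-sel x (maxL (y ∷ ys))
  ... | inj₁ e = subst (_∈ x ∷ y ∷ ys) (sym e) (here refl)
  ... | inj₂ e = subst (_∈ x ∷ y ∷ ys) (sym e) (there (maxL-∈′ y ys))

  <⇒≤∸1 : ∀ {x c} → x < c → x ≤ c ∸ 1
  <⇒≤∸1 {c = suc c} (s≤s le) = le

  ≤∸1⇒< : ∀ {x c} → x ≤ c ∸ 1 → 0 < c → x < c
  ≤∸1⇒< {c = suc c} le _ = s≤s le

  u-++ʳ : ∀ (w : List ℕ) {r} → Unique (w ++ r) → Unique r
  u-++ʳ [] u = u
  u-++ʳ (y ∷ w) u = u-++ʳ w (uTail u)

  Qs-len : ∀ y ys → length (Qs (y ∷ ys)) ≡ length ys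
  Qs-len y [] = refl
  Qs-len y (z ∷ zs) = cong suc (Qs-len z zs)

  ΦB-cons : ∀ m x (w : List ℕ) b bs →
    ΦBlocks m ((x , w) ∷ b ∷ bs) ≡ replicate (x ∸ m) U ++ replicate (suc (length w)) D ++ ΦBlocks x (b ∷ bs)
  ΦB-cons m x [] b bs = refl
  ΦB-cons m x (y ∷ w) b bs = refl


-- We decode
-- Φ σ block by block; the local condition Good determines each decoded
-- entry (chooseW-word, chooseD-tail), and the heights of the path count
-- the values ≤ the current maximum that are not yet used.
module DecodeEncode where

  open DyckPaths using (DyckFrom; nil)
  open Avoidance
  open Decoder
  open DecoderFacts
  open import Data.Nat
  open import Data.Nat.Properties
  open import Data.Nat.Tactic.RingSolver
  open import Data.Bool using (Bool; true; false)
  open import Data.List using (List; []; _∷_; _++_; length; replicate; span; foldr)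
  open import Data.List.Properties using (length-++; length-replicate; ++-identityʳ)
  open import Data.List.Membership.Propositional using (_∈_)
  open import Data.List.Membership.Propositional.Properties using (∈-++⁺ˡ; ∈-++⁺ʳ; ∈-++⁻)
  open import Data.List.Relation.Unary.Any using (here; there)
  open import Data.List.Relation.Unary.All using (All; []; _∷_)
  import Data.List.Relation.Unary.All as All
  import Data.List.Relation.Unary.All.Properties as AllP
  open import Data.List.Relation.Unary.Unique.Propositional using (Unique)
  open import Data.List.Relation.Unary.Unique.Propositional.Properties using (Unique[x∷xs]⇒x∉xs)
  open import Data.Product using (Σ; _×_; _,_; proj₁; proj₂)
  open import Data.Sum using (inj₁; inj₂)
  open import Data.Empty using (⊥-elim)
  open import Data.Unit using (⊤; tt)
  open import Relation.Nullary using (¬_; yes; no)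
  open import Relation.Binary.PropositionalEquality
  open import Function.Bundles using (Equivalence)

  module B (n : ℕ) where
    N : ℕ
    N = suc n

    loc-k1 : ∀ {mx y t' u c} → Loc k1 mx y t' → u ∈ t' → c ∈ t' → u ≢ c → y < c → ¬ u < y
    loc-k1 {u = u} {c} l ui ci ne yc uy with pairSub ui ci ne
    ... | inj₁ s = l u c s (inj₁ (uy , yc))
    ... | inj₂ s = l c u s (inj₂ (uy , yc))

    loc-k2 : ∀ {mx y t' u c} → Loc k2 mx y t' → u ∈ t' → c ∈ t' → u ≢ c → y < c → y < u → mx ≤ u
    loc-k2 {u = u} {c} l ui ci ne yc yu with pairSub ui ci ne
    ... | inj₁ s = proj₁ (l u c s yu yc)
    ... | inj₂ s = proj₂ (l c u s yc yu)

    LocAll : Kind → ℕ → List ℕ → Set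
    LocAll K mx [] = ⊤
    LocAll K mx (y ∷ ys) = Loc K mx y ys × LocAll K mx ys

    -- after the maximum N every entry is a non-maximum
    goodN⇒locAll : ∀ K t → All (InR n) t → Good K N t → LocAll K N t
    goodN⇒locAll K [] _ _ = tt
    goodN⇒locAll K (y ∷ ys) ((_ , yn) ∷ a) (l , g) =
      l (s≤s yn) , goodN⇒locAll K ys a (subst (λ z → Good K z ys) (m≥n⇒m⊔n≡m (≤-trans yn (n≤1+n n))) g)

    chooseD-tail : ∀ K y z zs → Unique (y ∷ z ∷ zs) → All (InR n) (y ∷ z ∷ zs) → Loc K N y (z ∷ zs) →
      y < maxL (z ∷ zs) → chooseD K N (availOf (y ∷ z ∷ zs)) ≡ y
    chooseD-tail k1 y z zs u a l yc = minS-char av N y py (≤-trans yn (n≤1+n n)) (availOf-true (here refl))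
      λ v pv vy → availOf-false λ { (here e) → <-irrefl e vy
                                   ; (there vi) → loc-k1 {mx = N} {u = v} {c = maxL (z ∷ zs)} l vi cIn (λ e → <-asym (subst (λ w → w < y) e vy) yc) yc vy }
      where
      av = availOf (y ∷ z ∷ zs)
      py = proj₁ (All.lookup a (here refl))
      yn = proj₂ (All.lookup a (here refl))
      cIn = maxL-∈′ z zs
    chooseD-tail k2 y z zs u a l yc = trans (cong (λ w → topBelow av (w ∸ 1)) e) (
      topBelow-char av (c ∸ 1) y py (<⇒≤∸1 yc) (availOf-true (here refl))
        λ v yv vc → availOf-false λ { (here e) → <-irrefl (sym e) yv
          ; (there vi) → <-irrefl refl (≤-<-trans (loc-k2 l vi cIn (λ e → <-irrefl e (≤∸1⇒< vc pc)) yc yv)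
                                                 (s≤s (proj₂ (All.lookup a (there vi))))) })
      where
      av = availOf (y ∷ z ∷ zs)
      c = maxL (z ∷ zs)
      py = proj₁ (All.lookup a (here refl))
      cIn = maxL-∈′ z zs
      pc = proj₁ (All.lookup a (there cIn))
      e : topBelow av N ≡ c
      e = topBelow-char av N c pc (≤-trans (proj₂ (All.lookup a (there cIn))) (n≤1+n n)) (availOf-true (there cIn))
        λ v cv vN → availOf-false λ { (here e) → <-asym yc (subst (c <_) e cv)
                                     ; (there vi) → <-irrefl refl (<-≤-trans cv (maxL-ub (z ∷ zs) vi)) }

    -- When the later entries are all below y the Q-step is U and the largest
    -- available value is y; otherwise it is D and chooseD gives y.
    decode-tail-head : ∀ K y z zs → Unique (y ∷ z ∷ zs) → All (InR n) (y ∷ z ∷ zs) → Loc K N y (z ∷ zs) →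
      let av = availOf (y ∷ z ∷ zs) in
      Dc.decL K N av (Qs (y ∷ z ∷ zs)) ≡ y ∷ Dc.decL K N (remove av y) (Qs (z ∷ zs))
    decode-tail-head K y z zs u a l with foldr _⊔_ 0 (z ∷ zs) ≤ᵇ y in eq
    ... | true = cong (λ x → x ∷ Dc.decL K N (remove av x) (Qs (z ∷ zs))) top≡y
      where
      av = availOf (y ∷ z ∷ zs)
      rest≤y : maxL (z ∷ zs) ≤ y
      rest≤y = ≤ᵇ⇒≤ _ _ (subst Data.Bool.T (sym eq) tt)
      top≡y : topBelow av N ≡ y
      top≡y = topBelow-char av N y (proj₁ (All.lookup a (here refl))) (≤-trans (proj₂ (All.lookup a (here refl))) (n≤1+n n))
        (availOf-true (here refl))
        λ v y<v _ → availOf-false λ { (here e) → <-irrefl (sym e) y<v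
                                     ; (there v∈) → <-irrefl refl (<-≤-trans y<v (≤-trans (maxL-ub (z ∷ zs) v∈) rest≤y)) }
    ... | false = cong (λ x → x ∷ Dc.decL K N (remove av x) (Qs (z ∷ zs)))
                       (chooseD-tail K y z zs u a l (≰⇒> (λ le → subst Data.Bool.T eq (≤⇒≤ᵇ le))))
      where av = availOf (y ∷ z ∷ zs)

    decode-tail : ∀ K y ys → Unique (y ∷ ys) → All (InR n) (y ∷ ys) → LocAll K N (y ∷ ys) →
      Dc.decL K N (availOf (y ∷ ys)) (Qs (y ∷ ys)) ≡ y ∷ ys
    decode-tail K y [] u a la = cong (_∷ []) (topBelow-char (availOf (y ∷ [])) N y
        (proj₁ (All.lookup a (here refl))) (≤-trans (proj₂ (All.lookup a (here refl))) (n≤1+n n)) (availOf-true (here refl))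
        λ v y<v _ → availOf-false λ { (here e) → <-irrefl (sym e) y<v ; (there ()) })
    decode-tail K y (z ∷ zs) u a (l , la) =
      trans (decode-tail-head K y z zs u a l)
            (cong (y ∷_) (trans (Dc.decL-ext K N (Qs (z ∷ zs)) (remove-availOf (Unique[x∷xs]⇒x∉xs u)))
                                (decode-tail K z zs (uTail u) (All.tail a) la)))

    cnt-allfalse : ∀ av k → (∀ u → 0 < u → u ≤ k → av u ≡ false) → cnt av k ≡ 0
    cnt-allfalse av zero f = refl
    cnt-allfalse av (suc k) f = trans (ifcong (f (suc k) (s≤s z≤n) ≤-refl) refl refl)
                                      (cnt-allfalse av k (λ u pu le → f u pu (≤-trans le (n≤1+n k))))

    chooseW-word : ∀ K x y t' → y < x → x < N → Unique (y ∷ t') → 0 < y → N ∈ t' → Loc K x y t' →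
      chooseW K (availOf (y ∷ t')) x ≡ y
    chooseW-word k1 x y t' yx xN u py NIn l =
      minS-char (availOf (y ∷ t')) x y py (<⇒≤ yx) (availOf-true (here refl))
        λ v pv vy → availOf-false λ { (here e) → <-irrefl e vy
          ; (there vi) → loc-k1 {mx = x} {u = v} {c = N} l vi NIn (λ e → <-irrefl e (<-trans vy (<-trans yx xN))) (<-trans yx xN) vy }
    chooseW-word k2 x y t' yx xN u py NIn l =
      topBelow-char (availOf (y ∷ t')) (x ∸ 1) y py (<⇒≤∸1 yx) (availOf-true (here refl))
        λ v yv vx → availOf-false λ { (here e) → <-irrefl (sym e) yv
          ; (there vi) → <-irrefl refl (≤-<-trans (loc-k2 {mx = x} {u = v} {c = N} l vi NIn
                            (λ e → <-irrefl e (<-trans (≤∸1⇒< vx (≤-<-trans z≤n yx)) xN)) (<-trans yx xN) yv)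
                            (≤∸1⇒< vx (≤-<-trans z≤n yx))) }

    good-drop : ∀ K x w r → All (_< x) w → Good K x (w ++ r) → Good K x r
    good-drop K x [] r a g = g
    good-drop K x (y ∷ w) r (yx ∷ a) (_ , g) = good-drop K x w r a (subst (λ z → Good K z (w ++ r)) (m≥n⇒m⊔n≡m (<⇒≤ yx)) g)

    decode-word : ∀ K x w r P' → All (_< x) w → Unique (w ++ r) → All (InR N) (w ++ r) → N ∈ r → x < N → Good K x (w ++ r) →
      Dc.decW K N x (availOf (w ++ r)) (replicate (length w) D ++ P') ≡ w ++ Dc.decW K N x (availOf r) P'
    decode-word K x [] r P' _ _ _ _ _ _ = refl
    decode-word K x (y ∷ w) r P' (yx ∷ aw) u a NIn xN (l , g) =
      subst (λ z → z ∷ Dc.decW K N x (remove av z) (replicate (length w) D ++ P') ≡ y ∷ w ++ Dc.decW K N x (availOf r) P')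
        (sym e) (cong (y ∷_) (trans (Dc.decW-ext K N x (replicate (length w) D ++ P') (remove-availOf (Unique[x∷xs]⇒x∉xs u)))
          (decode-word K x w r P' aw (uTail u) (All.tail a) NIn xN (subst (λ z → Good K z (w ++ r)) (m≥n⇒m⊔n≡m (<⇒≤ yx)) g))))
      where
      av = availOf (y ∷ w ++ r)
      e : chooseW K av x ≡ y
      e = chooseW-word K x y (w ++ r) yx xN u (proj₁ (All.lookup a (here refl))) (∈-++⁺ʳ w NIn) (l yx)

    decU-run : ∀ K m r j Q av → (∀ i → i < j → m + (r + i) ≢ N) →
      Dc.decU K N m r av (replicate j U ++ Q) ≡ Dc.decU K N m (r + j) av Q
    decU-run K m r zero Q av h = cong (λ z → Dc.decU K N m z av Q) (sym (+-identityʳ r))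
    decU-run K m r (suc j) Q av h =
      trans (cong (λ b → Dc.decU' K N b m r av (U ∷ replicate j U ++ Q)) (≡ᵇ-≢ (m + r) N (λ e → h 0 (s≤s z≤n) (trans (cong (m +_) (+-identityʳ r)) e))))
        (trans (decU-run K m (suc r) j Q av (λ i lt e → h (suc i) (s≤s lt) (trans (cong (m +_) (+-suc r i)) e)))
               (cong (λ z → Dc.decU K N m z av Q) (sym (+-suc r j))))

    -- ResP K m s P : P, read after the maximum m with the values of s unused,
    -- decodes to s; it is a path from height h = #(unused values ≤ m); and it
    -- has the length |P| = 2n + h − 2m that makes the total length 2n.
    ResP : Kind → ℕ → List ℕ → List Step → Set
    ResP K m s P = Dc.decW K N m (availOf s) P ≡ s × DyckFrom (cnt (availOf s) m) P ×
                   length P + (m + m) ≡ (n + n) + cnt (availOf s) m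

    split-lemma : ∀ m x → m < x → Σ ℕ λ d → x ∸ m ≡ suc d × m + suc d ≡ x
    split-lemma zero (suc x) _ = x , refl , refl
    split-lemma (suc m) (suc x) (s≤s lt) with split-lemma m x lt
    ... | d , e1 , e2 = d , e1 , cong suc e2

    balance-last : ∀ d L m h → h + d ≡ suc (suc L) → m + d ≡ suc n → d + L + (m + m) ≡ (n + n) + h
    balance-last d L m h E1 E2 = suc-injective (suc-injective (begin
        suc (suc (d + L + (m + m)))  ≡⟨ s1 d L m ⟩
        d + suc (suc L) + (m + m)    ≡⟨ cong (λ z → d + z + (m + m)) (sym E1) ⟩
        d + (h + d) + (m + m)        ≡⟨ s2 d h m ⟩
        (m + d) + (m + d) + h        ≡⟨ cong (λ z → z + z + h) E2 ⟩
        suc n + suc n + h            ≡⟨ s3 n h ⟩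
        suc (suc ((n + n) + h))      ∎))
      where
      open ≡-Reasoning
      s1 : ∀ d L m → suc (suc (d + L + (m + m))) ≡ d + suc (suc L) + (m + m)
      s1 = solve-∀
      s2 : ∀ d h m → d + (h + d) + (m + m) ≡ (m + d) + (m + d) + h
      s2 = solve-∀
      s3 : ∀ n h → suc n + suc n + h ≡ suc (suc ((n + n) + h))
      s3 = solve-∀

    balance-block : ∀ d W LP m h h' x → LP + (x + x) ≡ (n + n) + h' → h + d ≡ W + h' → m + d ≡ x →
         d + (W + LP) + (m + m) ≡ (n + n) + h
    balance-block d W LP m h h' x IH3 Eh Ex = +-cancelʳ-≡ h' _ _ (begin
        d + (W + LP) + (m + m) + h'  ≡⟨ s1 d W LP m h' ⟩
        d + (W + h') + LP + (m + m)  ≡⟨ cong (λ z → d + z + LP + (m + m)) (sym Eh) ⟩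
        d + (h + d) + LP + (m + m)   ≡⟨ s2 d h LP m ⟩
        h + (LP + ((m + d) + (m + d))) ≡⟨ cong (λ z → h + (LP + (z + z))) Ex ⟩
        h + (LP + (x + x))           ≡⟨ cong (h +_) IH3 ⟩
        h + ((n + n) + h')           ≡⟨ s3 h n h' ⟩
        (n + n) + h + h'             ∎)
      where
      open ≡-Reasoning
      s1 : ∀ d W LP m h' → d + (W + LP) + (m + m) + h' ≡ d + (W + h') + LP + (m + m)
      s1 = solve-∀
      s2 : ∀ d h LP m → d + (h + d) + LP + (m + m) ≡ h + (LP + ((m + d) + (m + d)))
      s2 = solve-∀
      s3 : ∀ h n h' → h + ((n + n) + h') ≡ (n + n) + h + h'
      s3 = solve-∀

    decode-lastBlock : ∀ K m y ys → Unique (N ∷ y ∷ ys) → All (InR N) (N ∷ y ∷ ys) → Good K m (N ∷ y ∷ ys) → m < N →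
         (∀ v → m < v → v ≤ N → v ∈ N ∷ y ∷ ys) →
         ResP K m (N ∷ y ∷ ys) (replicate (N ∸ m) U ++ Qs (y ∷ ys))
    decode-lastBlock K m y ys u a g mN full with split-lemma m N mN
    ... | d , eD , eM rewrite eD = decoded , dyck , len
      where
      av = availOf (N ∷ y ∷ ys)
      Q = Qs (y ∷ ys)
      below-N : All (InR n) (y ∷ ys)
      below-N = All.tabulate (λ {v} v∈ → proj₁ (All.lookup (All.tail a) v∈) ,
        s≤s⁻¹ (≤∧≢⇒< (proj₂ (All.lookup (All.tail a) v∈)) (λ e → Unique[x∷xs]⇒x∉xs u (subst (_∈ y ∷ ys) e v∈))))
      good-after-N : Good K N (y ∷ ys)
      good-after-N = subst (λ z → Good K z (y ∷ ys)) (m≤n⇒m⊔n≡n (<⇒≤ mN)) (proj₂ g)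
      run-below-N : ∀ i → i < d → m + (1 + i) ≢ N
      run-below-N i i<d e = <-irrefl (trans e (sym eM)) (+-monoʳ-< m (s≤s i<d))
      decoded : Dc.decW K N m av (U ∷ replicate d U ++ Q) ≡ N ∷ y ∷ ys
      decoded = trans (decU-run K m 1 d Q av run-below-N)
        (trans (cong (λ b → Dc.decU' K N b m (suc d) av Q) (≡ᵇ-true eM))
        (cong (N ∷_) (trans (Dc.decL-ext K N Q (remove-availOf (Unique[x∷xs]⇒x∉xs u)))
                            (decode-tail K y ys (uTail u) below-N (goodN⇒locAll K (y ∷ ys) below-N good-after-N)))))
      -- the run reaches height |w_k| + 1, more than the length of the Q-word
      height : cnt av m + suc d ≡ suc (suc (length ys))
      height = trans (sym (cnt-run av m (suc d) (λ v mv vd → availOf-true (full v mv (subst (v ≤_) eM vd)))))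
                     (trans (cong (cnt av) eM) (cnt-availOf N (N ∷ y ∷ ys) u a))
      dyck : DyckFrom (cnt av m) (U ∷ replicate d U ++ Q)
      dyck = dyck-Us (suc d) Q (dyck-short _ Q (subst (_≤ cnt av m + suc d) (sym (Qs-len y ys))
               (≤-trans (≤-trans (n≤1+n _) (n≤1+n _)) (≤-reflexive (sym height)))))
      len : length (U ∷ replicate d U ++ Q) + (m + m) ≡ (n + n) + cnt av m
      len = trans (cong (λ z → suc z + (m + m)) (trans (length-++ (replicate d U)) (cong₂ _+_ (length-replicate d) (Qs-len y ys))))
                  (balance-last (suc d) (length ys) m (cnt av m) height eM)

    cnt-N1 : cnt (availOf (N ∷ [])) n ≡ 0
    cnt-N1 = cnt-allfalse _ n λ u pu un → availOf-false λ { (here e) → <-irrefl refl (subst (_≤ n) e un) ; (there ()) }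

    decode-newMax : ∀ K m d av P → m + suc d < N →
      Dc.decW K N m av (U ∷ replicate d U ++ D ∷ P) ≡ (m + suc d) ∷ Dc.decW K N (m + suc d) (remove av (m + suc d)) P
    decode-newMax K m d av P lt =
      trans (decU-run K m 1 d (D ∷ P) av (λ i i<d e → <-irrefl e (<-trans (+-monoʳ-< m (s≤s i<d)) lt)))
            (cong (λ b → Dc.decU' K N b m (suc d) av (D ∷ P)) (≡ᵇ-≢ (m + suc d) N (<⇒≢ lt)))

    decode-final : ∀ K m w → Unique (N ∷ w) → All (InR N) (N ∷ w) → (∀ v → m < v → v ≤ N → v ∈ N ∷ w) →
      Good K m (N ∷ w) → m < N → ResP K m (N ∷ w) (ΦBlocks m ((N , w) ∷ []))
    decode-final K m [] u a full g mN with full (suc m) (n<1+n m) mN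
    ... | here e with suc-injective e
    ...   | refl = refl , nil , sym (trans (cong ((n + n) +_) cnt-N1) (+-identityʳ _))
    decode-final K m (y ∷ ys) u a full g mN = decode-lastBlock K m y ys u a g mN full

    decode-innerBlock : ∀ K x w r m {P′} → Unique (x ∷ w ++ r) → All (InR N) (x ∷ w ++ r) →
      (∀ v → m < v → v ≤ N → v ∈ x ∷ w ++ r) → Good K m (x ∷ w ++ r) → m < x → x < N →
      All (_< x) w → N ∈ r → ResP K x r P′ →
      ResP K m (x ∷ w ++ r) (replicate (x ∸ m) U ++ replicate (suc (length w)) D ++ P′)
    decode-innerBlock K x w r m {P′} u a full g mx x<N aw N∈r (dec-r , dyck-r , len-r)
      with split-lemma m x mx
    ... | d , eD , eM rewrite eD = decoded , dyck , len
      where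
      av = availOf (x ∷ w ++ r)
      h = cnt av m
      Dp = replicate (length w) D ++ P′
      gwr : Good K x (w ++ r)
      gwr = subst (λ z → Good K z (w ++ r)) (m≤n⇒m⊔n≡n (<⇒≤ mx)) (proj₂ g)
      decoded : Dc.decW K N m av (U ∷ replicate d U ++ D ∷ Dp) ≡ x ∷ w ++ r
      decoded = begin
          Dc.decW K N m av (U ∷ replicate d U ++ D ∷ Dp)
        ≡⟨ decode-newMax K m d av Dp (subst (_< N) (sym eM) x<N) ⟩
          (m + suc d) ∷ Dc.decW K N (m + suc d) (remove av (m + suc d)) Dp
        ≡⟨ cong (λ z → z ∷ Dc.decW K N z (remove av z) Dp) eM ⟩
          x ∷ Dc.decW K N x (remove av x) Dp
        ≡⟨ cong (x ∷_) (Dc.decW-ext K N x Dp (remove-availOf (Unique[x∷xs]⇒x∉xs u))) ⟩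
          x ∷ Dc.decW K N x (availOf (w ++ r)) Dp
        ≡⟨ cong (x ∷_) (decode-word K x w r P′ aw (uTail u) (All.tail a) N∈r x<N gwr) ⟩
          x ∷ w ++ Dc.decW K N x (availOf r) P′
        ≡⟨ cong (λ z → x ∷ w ++ z) dec-r ⟩
          x ∷ w ++ r
        ∎
        where open ≡-Reasoning
      below-x : All (InR x) (x ∷ w)
      below-x = (proj₁ (All.lookup a (here refl)) , ≤-refl) ∷
                All.tabulate (λ {v} v∈w → proj₁ (All.lookup a (there (∈-++⁺ˡ v∈w))) , <⇒≤ (All.lookup aw v∈w))
      height : h + suc d ≡ suc (length w) + cnt (availOf r) x
      height = trans (sym (cnt-run av m (suc d) (λ v mv vd → availOf-true (full v mv (≤-trans (subst (v ≤_) eM vd) (<⇒≤ x<N))))))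
                     (trans (cong (cnt av) eM) (cnt-availOf-++ x (x ∷ w) r u below-x))
      dyck : DyckFrom h (U ∷ replicate d U ++ D ∷ Dp)
      dyck = dyck-Us (suc d) (D ∷ Dp)
               (subst (λ z → DyckFrom z (D ∷ Dp)) (trans (+-comm (cnt (availOf r) x) (suc (length w))) (sym height))
                      (dyck-Ds (suc (length w)) P′ dyck-r))
      len : length (U ∷ replicate d U ++ D ∷ Dp) + (m + m) ≡ (n + n) + h
      len = trans (cong (_+ (m + m)) lenEq) (balance-block (suc d) (suc (length w)) (length P′) m h (cnt (availOf r) x) x len-r height eM)
        where
        lenEq : length (U ∷ replicate d U ++ D ∷ Dp) ≡ suc d + (suc (length w) + length P′)
        lenEq = cong suc (trans (length-++ (replicate d U)) (cong₂ _+_ (length-replicate d)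
                  (cong suc (trans (length-++ (replicate (length w) D)) (cong (_+ length P′) (length-replicate (length w)))))))

    mutual
      decode-blocks : ∀ K f x xs m → length xs < f → Unique (x ∷ xs) → All (InR N) (x ∷ xs) →
           (∀ v → m < v → v ≤ N → v ∈ x ∷ xs) → Good K m (x ∷ xs) → m < x → m < N →
           ResP K m (x ∷ xs) (ΦBlocks m (blocks (x ∷ xs)))
      decode-blocks K (suc f) x xs m lf u a full g mx mN = subst (ResP K m (x ∷ xs)) (sym (cong (ΦBlocks m) bc)) res
        where
        w = proj₁ (span (λ y → y <? x) xs)
        r = proj₂ (span (λ y → y <? x) xs)
        sr : SpanR x xs w r
        sr = span-lemma x xs
        bc : blocks (x ∷ xs) ≡ (x , w) ∷ blocks r
        bc = blocks-cons x xs
        res : ResP K m (x ∷ xs) (ΦBlocks m ((x , w) ∷ blocks r))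
        res = subst (λ z → ResP K m (x ∷ z) (ΦBlocks m ((x , w) ∷ blocks r))) (sym (proj₁ sr))
          (decode-blocks-split K f x w r m (subst (λ z → length z ≤ f) (proj₁ sr) (s≤s⁻¹ lf))
            (subst (λ z → Unique (x ∷ z)) (proj₁ sr) u) (subst (λ z → All (InR N) (x ∷ z)) (proj₁ sr) a)
            (subst (λ z → ∀ v → m < v → v ≤ N → v ∈ x ∷ z) (proj₁ sr) full)
            (subst (λ z → Good K m (x ∷ z)) (proj₁ sr) g) mx mN (proj₁ (proj₂ sr)) (proj₂ (proj₂ sr)))

      decode-blocks-split : ∀ K f x w r m → length (w ++ r) ≤ f → Unique (x ∷ w ++ r) → All (InR N) (x ∷ w ++ r) →
            (∀ v → m < v → v ≤ N → v ∈ x ∷ w ++ r) → Good K m (x ∷ w ++ r) → m < x → m < N →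
            All (_< x) w → (∀ y ys → r ≡ y ∷ ys → ¬ y < x) →
            ResP K m (x ∷ w ++ r) (ΦBlocks m ((x , w) ∷ blocks r))
      decode-blocks-split K f x w r m lf u a full g mx mN aw hr with x ≟ N
      decode-blocks-split K f .N w [] m lf u a full g mx mN aw hr | yes refl =
        subst (λ z → ResP K m (N ∷ z) (ΦBlocks m ((N , w) ∷ []))) (sym (++-identityʳ w))
          (decode-final K m w (subst (λ z → Unique (N ∷ z)) (++-identityʳ w) u)
                              (subst (λ z → All (InR N) (N ∷ z)) (++-identityʳ w) a)
                              (subst (λ z → ∀ v → m < v → v ≤ N → v ∈ N ∷ z) (++-identityʳ w) full)
                              (subst (λ z → Good K m (N ∷ z)) (++-identityʳ w) g) mN)
      decode-blocks-split K f .N w (y ∷ ys) m lf u a full g mx mN aw hr | yes refl =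
        ⊥-elim (hr y ys refl (≤∧≢⇒< (proj₂ (All.lookup a (there yin))) (λ e → Unique[x∷xs]⇒x∉xs u (subst (_∈ w ++ y ∷ ys) e yin))))
        where yin = ∈-++⁺ʳ w {y ∷ ys} (here refl)
      decode-blocks-split K f x w [] m lf u a full g mx mN aw hr | no xN with full N (<-trans mx (≤∧≢⇒< (proj₂ (All.lookup a (here refl))) xN)) ≤-refl
      ... | here e = ⊥-elim (xN (sym e))
      ... | there p with ∈-++⁻ w p
      ...   | inj₁ Nw = ⊥-elim (<-asym (All.lookup aw Nw) (≤∧≢⇒< (proj₂ (All.lookup a (here refl))) xN))
      ...   | inj₂ ()
      decode-blocks-split K f x w (x' ∷ xs') m lf u a full g mx mN aw hr | no x≢N =
        subst (ResP K m (x ∷ w ++ r)) (sym code)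
          (decode-innerBlock K x w r m u a full g mx x<N aw N∈r
            (decode-blocks K f x' xs' x shorter (u-++ʳ w (uTail u)) (AllP.++⁻ʳ w (All.tail a))
              full-r good-r x<x' x<N))
        where
        r = x' ∷ xs'
        x<N : x < N
        x<N = ≤∧≢⇒< (proj₂ (All.lookup a (here refl))) x≢N
        code : ΦBlocks m ((x , w) ∷ blocks r) ≡ replicate (x ∸ m) U ++ replicate (suc (length w)) D ++ ΦBlocks x (blocks r)
        code = trans (cong (λ bs → ΦBlocks m ((x , w) ∷ bs)) (blocks-cons x' xs'))
                     (trans (ΦB-cons m x w _ _)
                            (cong (λ bs → replicate (x ∸ m) U ++ replicate (suc (length w)) D ++ ΦBlocks x bs)
                                  (sym (blocks-cons x' xs'))))
        x<x' : x < x'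
        x<x' = ≤∧≢⇒< (≮⇒≥ (hr x' xs' refl))
                     (λ e → Unique[x∷xs]⇒x∉xs u (subst (_∈ w ++ r) (sym e) (∈-++⁺ʳ w (here refl))))
        full-r : ∀ v → x < v → v ≤ N → v ∈ r
        full-r v x<v v≤N with full v (<-trans mx x<v) v≤N
        ... | here e = ⊥-elim (<-irrefl (sym e) x<v)
        ... | there p with ∈-++⁻ w p
        ...   | inj₁ v∈w = ⊥-elim (<-asym x<v (All.lookup aw v∈w))
        ...   | inj₂ v∈r = v∈r
        N∈r : N ∈ r
        N∈r = full-r N x<N ≤-refl
        good-r : Good K x r
        good-r = good-drop K x w r aw (subst (λ z → Good K z (w ++ r)) (m≤n⇒m⊔n≡n (<⇒≤ mx)) (proj₂ g))
        shorter : length xs' < f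
        shorter = ≤-trans (≤-trans (m≤n+m (suc (length xs')) (length w)) (≤-reflexive (sym (length-++ w)))) lf

    ψ-Φ : ∀ K σ → Permutations.PermSpec N σ → Good K 0 σ →
      Dc.decW K N 0 (availOf σ) (Φ σ) ≡ σ × DyckFrom 0 (Φ σ) × length (Φ σ) ≡ n + n
    ψ-Φ K [] (u , sp) g with Equivalence.from (sp N) (s≤s z≤n , ≤-refl)
    ... | ()
    ψ-Φ K (x ∷ xs) (u , sp) g with decode-blocks K (suc (length xs)) x xs 0 ≤-refl u
          (All.tabulate (λ {v} vin → Equivalence.to (sp v) vin))
          (λ v pv vN → Equivalence.from (sp v) (pv , vN)) g
          (proj₁ (Equivalence.to (sp x) (here refl))) (s≤s z≤n)
    ... | (c1 , c2 , c3) = c1 , c2 , trans (sym (+-identityʳ _)) (trans c3 (+-identityʳ _))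

    availOf-perm : ∀ σ → Permutations.PermSpec N σ → availOf σ ≐ range N
    availOf-perm σ (_ , spec) v = bool-ext
      (λ e → let (pos , bounded) = Equivalence.to (spec v) (availOf-∈ e) in range-complete N v pos bounded)
      (λ e → availOf-true (Equivalence.from (spec v) (range-sound N v e)))

    ψ∘Φ : ∀ K σ → Permutations.PermSpec N σ → Good K 0 σ → ψ K N (Φ σ) ≡ σ
    ψ∘Φ K σ perm good =
      trans (sym (Dc.decW-ext K N 0 (Φ σ) (availOf-perm σ perm))) (proj₁ (ψ-Φ K σ perm good))


-- The decoder is run on an arbitrary path; invariants (InvW, InvU,
-- InvL) relate the unused values to the height of the rest of the path, and
-- the outputs (OutW, OutU, OutL) record that the decoded list is
-- duplicate-free, uses exactly the unused values, satisfies Good, and is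
-- encoded by Φ into the path.
module EncodeDecode where

  open DyckPaths using (DyckFrom; up; down)
  open Avoidance
  open Decoder
  open DecoderFacts
  open import Data.Nat
  open import Data.Nat.Properties
  open import Data.Nat.Tactic.RingSolver
  open import Data.Bool using (Bool; true; false; if_then_else_)
  open import Data.List using (List; []; _∷_; _++_; length; replicate)
  open import Data.List.Properties using (++-identityʳ)
  open import Data.List.Membership.Propositional using (_∈_; _∉_)
  open import Data.List.Relation.Unary.Any using (here; there)
  open import Data.List.Relation.Unary.All using (All; []; _∷_)
  import Data.List.Relation.Unary.All as All
  open import Data.List.Relation.Unary.AllPairs using ([]; _∷_)
  open import Data.List.Relation.Unary.Unique.Propositional using (Unique)
  open import Data.List.Relation.Binary.Sublist.Propositional using (_⊆_)
  open import Data.List.Relation.Binary.Sublist.Propositional.Properties using (Any-resp-⊆)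
  open import Data.Product using (Σ; _×_; _,_; proj₁; proj₂)
  open import Data.Sum using (inj₁; inj₂)
  open import Data.Empty using (⊥; ⊥-elim)
  open import Data.Unit using (tt)
  open import Relation.Nullary using (¬_; yes; no)
  open import Relation.Binary.PropositionalEquality

  open import Data.Bool.Properties using (T-≡)
  open import Function.Bundles using (Equivalence; mk⇔)
  open import Relation.Binary.Definitions using (tri<; tri≈; tri>)

  mkUnique : ∀ {x : ℕ} {xs} → x ∉ xs → Unique xs → Unique (x ∷ xs)
  mkUnique {x} {xs} nin u = All.tabulate (λ {v} vin e → nin (subst (_∈ xs) (sym e) vin)) ∷ u

  maxL-lub : ∀ {x} ys → All (_≤ x) ys → maxL ys ≤ x
  maxL-lub [] [] = z≤n
  maxL-lub (y ∷ ys) (le ∷ a) = ⊔-lub le (maxL-lub ys a)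

  cnt-none-run : ∀ av k j → (∀ u → k < u → u ≤ k + j → av u ≡ false) → cnt av (k + j) ≡ cnt av k
  cnt-none-run av k zero f = cong (cnt av) (+-identityʳ k)
  cnt-none-run av k (suc j) f =
    trans (cong (cnt av) (+-suc k j))
    (trans (ifcong (f (suc (k + j)) (s≤s (m≤m+n k j)) (≤-reflexive (sym (+-suc k j)))) refl refl)
           (cnt-none-run av k j (λ u l1 l2 → f u l1 (≤-trans l2 (≤-trans (n≤1+n _) (≤-reflexive (sym (+-suc k j))))))))

  cnt-pred-false : ∀ av m → av m ≡ false → cnt av m ≡ cnt av (m ∸ 1)
  cnt-pred-false av zero e = refl
  cnt-pred-false av (suc m) e = ifcong e refl refl

  blocks-char : ∀ x w σ₂ → All (_< x) w → (∀ y ys → σ₂ ≡ y ∷ ys → ¬ y < x) → blocks (x ∷ w ++ σ₂) ≡ (x , w) ∷ blocks σ₂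
  blocks-char x w σ₂ a h = trans (blocks-cons x (w ++ σ₂)) (cong (λ p → (x , proj₁ p) ∷ blocks (proj₂ p)) (span-char x w σ₂ a h))

  rep-snoc : ∀ (r : ℕ) (q : List Step) → replicate (suc r) U ++ q ≡ replicate r U ++ U ∷ q
  rep-snoc zero q = refl
  rep-snoc (suc r) q = cong (U ∷_) (rep-snoc r q)

  module P (n : ℕ) where
    N : ℕ
    N = suc n

    Mem : List ℕ → Avail → Set
    Mem σ av = ∀ v → (v ∈ σ → av v ≡ true) × (av v ≡ true → v ∈ σ)

    NonEmpty : List ℕ → Set
    NonEmpty σ = Σ ℕ λ y → Σ (List ℕ) λ ys → σ ≡ y ∷ ys

    HeadGt : ℕ → List ℕ → Set
    HeadGt m σ = Σ ℕ λ x → Σ (List ℕ) λ xs → σ ≡ x ∷ xs × m < x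

    mem-removed : ∀ {av x τ} → Mem τ (remove av x) → ∀ {c} → c ∈ τ → av c ≡ true × c ≢ x
    mem-removed {av} {x} m {c} c∈ = remove-true av x c (proj₁ (m c) c∈)

    prepend : ∀ {x σ av} → av x ≡ true → Unique σ → Mem σ (remove av x) →
      Unique (x ∷ σ) × Mem (x ∷ σ) av
    prepend {x} {σ} {av} ax u m = mkUnique x∉σ u , mem
      where
      x∉σ : x ∉ σ
      x∉σ x∈σ = true≢false (trans (sym (proj₁ (m x) x∈σ)) (remove-self av x))
      mem : Mem (x ∷ σ) av
      mem v = to , from
        where
        to : v ∈ x ∷ σ → av v ≡ true
        to (here refl) = ax
        to (there v∈) = proj₁ (mem-removed m v∈)
        from : av v ≡ true → v ∈ x ∷ σ
        from avv with v ≟ x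
        ... | yes refl = here refl
        ... | no v≢x = there (proj₂ (m v) (trans (remove-other av x v v≢x) avv))

    record InvL (av : Avail) (q : List Step) : Set where
      field
        j1 : ∀ u → av u ≡ true → 0 < u × u < N
        j2 : cnt av N ≡ suc (length q)

    record OutL (K : Kind) (av : Avail) (q : List Step) (τ : List ℕ) : Set where
      field
        unique : Unique τ
        mem : Mem τ av
        good : Good K N τ
        code : Qs τ ≡ q
        nonempty : NonEmpty τ

    invL-step : ∀ {av q s} x → InvL av (s ∷ q) → 0 < x → x ≤ N → av x ≡ true → InvL (remove av x) q
    invL-step {av} {q} x inv px xN ax = record
      { j1 = λ u e → InvL.j1 inv u (proj₁ (remove-true av x u e))
      ; j2 = suc-injective (trans (cnt-remove-in av N x px xN ax) (InvL.j2 inv)) }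

    sub∈₁ : ∀ {c d : ℕ} {t} → (c ∷ d ∷ []) ⊆ t → c ∈ t
    sub∈₁ s = Any-resp-⊆ s (here refl)

    sub∈₂ : ∀ {c d : ℕ} {t} → (c ∷ d ∷ []) ⊆ t → d ∈ t
    sub∈₂ s = Any-resp-⊆ s (there (here refl))

    ¬T⇒false : ∀ {b} → ¬ Data.Bool.T b → b ≡ false
    ¬T⇒false {true} f = ⊥-elim (f tt)
    ¬T⇒false {false} _ = refl

    qs-U : ∀ x τ → NonEmpty τ → maxL τ ≤ x → Qs (x ∷ τ) ≡ U ∷ Qs τ
    qs-U x .(y ∷ ys) (y , ys , refl) le = cong (λ b → (if b then U else D) ∷ Qs (y ∷ ys)) (Equivalence.to T-≡ (≤⇒≤ᵇ le))

    qs-D : ∀ x τ → NonEmpty τ → x < maxL τ → Qs (x ∷ τ) ≡ D ∷ Qs τ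
    qs-D x .(y ∷ ys) (y , ys , refl) lt =
      cong (λ b → (if b then U else D) ∷ Qs (y ∷ ys)) (¬T⇒false (λ t → <⇒≱ lt (≤ᵇ⇒≤ _ _ t)))

    AboveD : Kind → ℕ → Avail → Set
    AboveD k1 x av = ∀ u → 0 < u → u < x → av u ≡ false
    AboveD k2 x av = Σ ℕ λ y₀ → x < y₀ × av y₀ ≡ true × (∀ u → x < u → u ≤ N → u ≢ y₀ → av u ≡ false)

    chooseD-spec : ∀ K av q → InvL av (D ∷ q) →
      let x = chooseD K N av in 0 < x × x ≤ N × av x ≡ true × AboveD K x av
    chooseD-spec k1 av q inv = ms-pos , ms-bound , ms-avail , ms-least
      where open MSspec (minS-found av N (subst (0 <_) (sym (InvL.j2 inv)) (s≤s z≤n)))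
    chooseD-spec k2 av q inv = tb-pos , ≤-trans (<⇒≤ x<y₀) y₀≤N , tb-avail , y₀ , x<y₀ , y₀-avail , others
      where
      open InvL inv
      y₀ = topBelow av N
      open TBspec (topBelow-found av N (subst (0 <_) (sym j2) (s≤s z≤n)))
        renaming (tb-pos to y₀-pos; tb-bound to y₀≤N; tb-avail to y₀-avail; tb-top to above-y₀)
      -- y₀ is the largest available value, so at least one is available below it
      cnt-y₀ : cnt av N ≡ suc (cnt av (y₀ ∸ 1))
      cnt-y₀ = trans (cong (cnt av) (sym (m+[n∸m]≡n y₀≤N)))
        (trans (cnt-none-run av y₀ (N ∸ y₀) (λ u l1 l2 → above-y₀ u l1 (subst (u ≤_) (m+[n∸m]≡n y₀≤N) l2)))
               (cnt-suc-avail y₀ y₀-pos y₀-avail))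
        where
        cnt-suc-avail : ∀ y → 0 < y → av y ≡ true → cnt av y ≡ suc (cnt av (y ∸ 1))
        cnt-suc-avail (suc y) _ e = ifcong e refl refl
      below-y₀ : 0 < cnt av (y₀ ∸ 1)
      below-y₀ = subst (0 <_) (sym (suc-injective (trans (sym cnt-y₀) j2))) (s≤s z≤n)
      open TBspec (topBelow-found av (y₀ ∸ 1) below-y₀)
      x<y₀ : topBelow av (y₀ ∸ 1) < y₀
      x<y₀ = ≤∸1⇒< tb-bound y₀-pos
      others : ∀ u → topBelow av (y₀ ∸ 1) < u → u ≤ N → u ≢ y₀ → av u ≡ false
      others u x<u u≤N u≢y₀ with <-cmp u y₀
      ... | tri< u<y₀ _ _ = tb-top u x<u (<⇒≤∸1 u<y₀)
      ... | tri≈ _ u≡y₀ _ = ⊥-elim (u≢y₀ u≡y₀)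
      ... | tri> _ _ y₀<u = above-y₀ u y₀<u u≤N

    locD : ∀ K x av τ → (∀ u → av u ≡ true → 0 < u × u < N) → AboveD K x av →
      Mem τ (remove av x) → Unique τ → NonEmpty τ → Loc K N x τ × x < maxL τ
    locD k1 x av τ range below mem u (y , ys , τ≡) = loc , <-≤-trans (above (y∈ )) (maxL-ub τ y∈)
      where
      y∈ : y ∈ τ
      y∈ = subst (y ∈_) (sym τ≡) (here refl)
      above : ∀ {c} → c ∈ τ → x < c
      above {c} c∈ with mem-removed mem c∈
      ... | ac , c≢x = ≤∧≢⇒< (≮⇒≥ (λ c<x → true≢false (trans (sym ac) (below c (proj₁ (range c ac)) c<x))))
                             (λ e → c≢x (sym e))
      loc : Loc k1 N x τ
      loc c d s (inj₁ (c<x , _)) = <-asym c<x (above (sub∈₁ s))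
      loc c d s (inj₂ (d<x , _)) = <-asym d<x (above (sub∈₂ s))
    locD k2 x av τ range (y₀ , x<y₀ , ay₀ , others) mem u _ = loc , <-≤-trans x<y₀ (maxL-ub τ y₀∈)
      where
      y₀∈ : y₀ ∈ τ
      y₀∈ = proj₂ (mem y₀) (trans (remove-other av x y₀ (λ e → <-irrefl (sym e) x<y₀)) ay₀)
      is-y₀ : ∀ {c} → c ∈ τ → x < c → c ≡ y₀
      is-y₀ {c} c∈ x<c with c ≟ y₀
      ... | yes c≡y₀ = c≡y₀
      ... | no c≢y₀ with mem-removed mem c∈
      ...   | ac , _ = ⊥-elim (true≢false (trans (sym ac) (others c x<c (<⇒≤ (proj₂ (range c ac))) c≢y₀)))
      loc : Loc k2 N x τ
      loc c d s x<c x<d with uniqSub u s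
      ... | (c≢d ∷ []) ∷ _ = ⊥-elim (c≢d (trans (is-y₀ (sub∈₁ s) x<c) (sym (is-y₀ (sub∈₂ s) x<d))))

    -- After a U of the Q-word the largest available value x is decoded: all
    -- later entries are below it.
    locU : ∀ K x τ → (∀ {c} → c ∈ τ → c < x) → Loc K N x τ
    locU k1 x τ below c d s (inj₁ (_ , x<d)) = <-asym x<d (below (sub∈₂ s))
    locU k1 x τ below c d s (inj₂ (_ , x<c)) = <-asym x<c (below (sub∈₁ s))
    locU k2 x τ below c d s x<c x<d = ⊥-elim (<-asym x<c (below (sub∈₁ s)))

    decL-sound : ∀ K av q → InvL av q → OutL K av q (Dc.decL K N av q)
    decL-sound K av [] inv = record
      { unique = [] ∷ [] ; mem = mem ; good = locNil K , tt ; code = refl ; nonempty = _ , _ , refl }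
      where
      open InvL inv
      x = topBelow av N
      open TBspec (topBelow-found av N (subst (0 <_) (sym j2) (s≤s z≤n)))
      -- x was the only available value
      mem : Mem (x ∷ []) av
      mem v = (λ { (here refl) → tb-avail }) , from
        where
        from : av v ≡ true → v ∈ x ∷ []
        from avv with v ≟ x
        ... | yes e = here e
        ... | no v≢x = ⊥-elim (true≢false (trans (sym (trans (remove-other av x v v≢x) avv))
                        (cnt-zero (remove av x) N (suc-injective (trans (cnt-remove-in av N x tb-pos tb-bound tb-avail) j2))
                          v (proj₁ (j1 v avv)) (<⇒≤ (proj₂ (j1 v avv))))))
      locNil : ∀ K → x < N → Loc K N x []
      locNil k1 _ c d ()
      locNil k2 _ c d ()
    decL-sound K av (U ∷ q) inv = record
      { unique = proj₁ xτ ; mem = proj₂ xτ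
      ; good = (λ _ → locU K x τ below) , subst (λ z → Good K z τ) (sym (m≥n⇒m⊔n≡m tb-bound)) IH.good
      ; code = trans (qs-U x τ IH.nonempty (maxL-lub τ (All.tabulate (λ c∈ → <⇒≤ (below c∈))))) (cong (U ∷_) IH.code)
      ; nonempty = x , τ , refl }
      where
      open InvL inv
      x = topBelow av N
      open TBspec (topBelow-found av N (subst (0 <_) (sym j2) (s≤s z≤n)))
      τ = Dc.decL K N (remove av x) q
      module IH = OutL (decL-sound K (remove av x) q (invL-step x inv tb-pos tb-bound tb-avail))
      xτ = prepend tb-avail IH.unique IH.mem
      below : ∀ {c} → c ∈ τ → c < x
      below {c} c∈ with mem-removed IH.mem c∈
      ... | ac , c≢x = ≤∧≢⇒< (≮⇒≥ (λ x<c → true≢false (trans (sym ac) (tb-top c x<c (<⇒≤ (proj₂ (j1 c ac))))))) c≢x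
    decL-sound K av (D ∷ q) inv with chooseD-spec K av q inv
    ... | px , xN , ax , above = record
      { unique = proj₁ xτ ; mem = proj₂ xτ
      ; good = (λ _ → proj₁ loc) , subst (λ z → Good K z τ) (sym (m≥n⇒m⊔n≡m xN)) IH.good
      ; code = trans (qs-D x τ IH.nonempty (proj₂ loc)) (cong (D ∷_) IH.code)
      ; nonempty = x , τ , refl }
      where
      x = chooseD K N av
      τ = Dc.decL K N (remove av x) q
      module IH = OutL (decL-sound K (remove av x) q (invL-step x inv px xN ax))
      xτ = prepend ax IH.unique IH.mem
      loc = locD K x av τ (InvL.j1 inv) above IH.mem IH.unique IH.nonempty

    record InvW (m : ℕ) (av : Avail) (q : List Step) : Set where
      field
        i1 : ∀ u → av u ≡ true → 0 < u × u ≤ N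
        i2 : ∀ u → m < u → u ≤ N → av u ≡ true
        i0 : av m ≡ false
        i3 : m < N
        i4 : DyckFrom (cnt av m) q
        i5 : length q + (m + m) ≡ (n + n) + cnt av m

    record InvU (m r : ℕ) (av : Avail) (q : List Step) : Set where
      field
        u1 : ∀ u → av u ≡ true → 0 < u × u ≤ N
        u2 : ∀ u → m < u → u ≤ N → av u ≡ true
        u0 : 0 < r
        u3 : m + r ≤ N
        u4 : DyckFrom (cnt av (m + r)) q
        u5 : length q + ((m + r) + (m + r)) ≡ (n + n) + cnt av (m + r)

    record SplitW (m : ℕ) (σ : List ℕ) (q : List Step) : Set where
      constructor splitW
      field
        word rest : List ℕ
        restCode : List Step
        σ≡ : σ ≡ word ++ rest
        q≡ : q ≡ replicate (length word) D ++ restCode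
        word<m : All (_< m) word
        headGt : HeadGt m rest
        restΦ : ΦBlocks m (blocks rest) ≡ restCode

    record OutW (K : Kind) (m : ℕ) (av : Avail) (q : List Step) (σ : List ℕ) : Set where
      field
        unique : Unique σ
        mem : Mem σ av
        good : Good K m σ
        split : SplitW m σ q

    record OutU (K : Kind) (m r : ℕ) (av : Avail) (q : List Step) (σ : List ℕ) : Set where
      field
        unique : Unique σ
        mem : Mem σ av
        good : Good K m σ
        headGt : HeadGt m σ
        code : ΦBlocks m (blocks σ) ≡ replicate r U ++ q

    balance-end : ∀ m h → m ≤ n → m + m ≡ (n + n) + h → m ≡ n × h ≡ 0
    balance-end m h le e = m≡n , h≡0
      where
      h≡0 : h ≡ 0
      h≡0 = n≤0⇒n≡0 (+-cancelˡ-≤ (n + n) h 0 (≤-trans (≤-reflexive (sym e)) (≤-trans (+-mono-≤ le le) (≤-reflexive (sym (+-identityʳ (n + n)))))))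
      m≡n : m ≡ n
      m≡n with m≤n⇒m<n∨m≡n le
      ... | inj₂ e' = e'
      ... | inj₁ lt = ⊥-elim (<-irrefl (trans e (trans (cong ((n + n) +_) h≡0) (+-identityʳ _))) (+-mono-< lt lt))

    balance-up : ∀ L M h → suc L + (M + M) ≡ (n + n) + h → L + ((M + 1) + (M + 1)) ≡ (n + n) + (h + 1)
    balance-up L M h e = trans (s1 L M) (trans (cong suc e) (s2 (n + n) h))
      where
      s1 : ∀ L M → L + ((M + 1) + (M + 1)) ≡ suc (suc L + (M + M))
      s1 = solve-∀
      s2 : ∀ X h → suc (X + h) ≡ X + (h + 1)
      s2 = solve-∀

    balance-down : ∀ L M h → suc L + (M + M) ≡ (n + n) + suc h → L + (M + M) ≡ (n + n) + h
    balance-down L M h e = suc-injective (trans e (+-suc (n + n) h))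

    balance-full : ∀ L H → L + (suc n + suc n) ≡ (n + n) + H → H ≡ suc (suc L)
    balance-full L H e = +-cancelˡ-≡ (n + n) _ _ (trans (sym e) (s1 L n))
      where
      s1 : ∀ L n → L + (suc n + suc n) ≡ (n + n) + suc (suc L)
      s1 = solve-∀

    dyckD : ∀ {h q} → DyckFrom h (D ∷ q) → Σ ℕ λ h' → h ≡ suc h' × DyckFrom h' q
    dyckD (down d) = _ , refl , d

    dyckD-pos : ∀ {h q} → DyckFrom h (D ∷ q) → 0 < h
    dyckD-pos (down d) = s≤s z≤n

    dyckU : ∀ {h q} → DyckFrom h (U ∷ q) → DyckFrom (suc h) q
    dyckU (up d) = d

    invW-step : ∀ {m av q} x → InvW m av (D ∷ q) → 0 < x → x < m → av x ≡ true → InvW m (remove av x) q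
    invW-step {m} {av} {q} x inv px x<m ax with dyckD (InvW.i4 inv)
    ... | h' , eh , d = record
      { i1 = λ u e → i1 u (proj₁ (remove-true av x u e))
      ; i2 = λ u m<u u≤N → trans (remove-other av x u (λ e → <-asym x<m (subst (m <_) e m<u))) (i2 u m<u u≤N)
      ; i0 = trans (remove-other av x m (λ e → <-irrefl (sym e) x<m)) i0
      ; i3 = i3
      ; i4 = subst (λ z → DyckFrom z q) (sym cr) d
      ; i5 = trans (balance-down (length q) m h' (subst (λ z → suc (length q) + (m + m) ≡ (n + n) + z) eh i5))
                   (cong ((n + n) +_) (sym cr)) }
      where
      open InvW inv
      cr : cnt (remove av x) m ≡ h'
      cr = suc-injective (trans (cnt-remove-in av m x px (<⇒≤ x<m) ax) eh)

    invW⇒invU : ∀ {m av q} → InvW m av (U ∷ q) → InvU m 1 av q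
    invW⇒invU {m} {av} {q} inv = record
      { u1 = i1 ; u2 = i2 ; u0 = s≤s z≤n
      ; u3 = m+1≤N
      ; u4 = subst (λ z → DyckFrom z q) (trans (+-comm 1 (cnt av m)) (sym cr)) (dyckU i4)
      ; u5 = trans (balance-up (length q) m (cnt av m) i5) (cong ((n + n) +_) (sym cr)) }
      where
      open InvW inv
      m+1≤N : m + 1 ≤ N
      m+1≤N = ≤-trans (≤-reflexive (+-comm m 1)) i3
      cr : cnt av (m + 1) ≡ cnt av m + 1
      cr = cnt-run av m 1 (λ u m<u u≤ → i2 u m<u (≤-trans u≤ m+1≤N))

    invU-step : ∀ {m r av q} → InvU m r av (U ∷ q) → m + r ≢ N → InvU m (suc r) av q
    invU-step {m} {r} {av} {q} inv m+r≢N = record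
      { u1 = u1 ; u2 = u2 ; u0 = s≤s z≤n
      ; u3 = ≤-trans (≤-reflexive (+-suc m r)) m+r<N
      ; u4 = subst (λ z → DyckFrom z q) (sym cr) (dyckU u4)
      ; u5 = trans (cong (λ z → length q + (z + z)) (+-suc m r))
               (trans (trans (sym (cong (λ z → length q + (z + z)) (+-comm (m + r) 1)))
                             (trans (balance-up (length q) (m + r) (cnt av (m + r)) u5)
                                    (cong ((n + n) +_) (+-comm (cnt av (m + r)) 1))))
                      (cong ((n + n) +_) (sym cr))) }
      where
      open InvU inv
      m+r<N : m + r < N
      m+r<N = ≤∧≢⇒< u3 m+r≢N
      cr : cnt av (m + suc r) ≡ suc (cnt av (m + r))
      cr = trans (cong (cnt av) (+-suc m r)) (ifcong (u2 (suc (m + r)) (s≤s (m≤m+n m r)) m+r<N) refl refl)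

    invU⇒invW : ∀ {m r av q} → InvU m r av (D ∷ q) → m + r ≢ N → InvW (m + r) (remove av (m + r)) q
    invU⇒invW {m} {r} {av} {q} inv M≢N with dyckD (InvU.u4 inv)
    ... | h' , eh , d = record
      { i1 = λ u e → u1 u (proj₁ (remove-true av M u e))
      ; i2 = λ u M<u u≤N → trans (remove-other av M u (λ e → <-irrefl (sym e) M<u)) (u2 u (<-trans m<M M<u) u≤N)
      ; i0 = remove-self av M
      ; i3 = ≤∧≢⇒< u3 M≢N
      ; i4 = subst (λ z → DyckFrom z q) (sym cr) d
      ; i5 = trans (balance-down (length q) M h' (subst (λ z → suc (length q) + (M + M) ≡ (n + n) + z) eh u5))
                   (cong ((n + n) +_) (sym cr)) }
      where
      open InvU inv
      M = m + r
      m<M : m < M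
      m<M = m<m+n m u0
      cr : cnt (remove av M) M ≡ h'
      cr = suc-injective (trans (cnt-remove-in av M M (<-≤-trans (s≤s z≤n) m<M) ≤-refl (u2 M m<M u3)) eh)

    invU⇒invL : ∀ {m r av q} → InvU m r av q → m + r ≡ N → InvL (remove av N) q
    invU⇒invL {m} {r} {av} {q} inv m+r≡N = record
      { j1 = λ u e → let (a , u≢N) = remove-true av N u e in proj₁ (u1 u a) , ≤∧≢⇒< (proj₂ (u1 u a)) u≢N
      ; j2 = suc-injective (trans (cnt-remove-in av N N (s≤s z≤n) ≤-refl (u2 N m<N ≤-refl)) cnt-N) }
      where
      open InvU inv
      m<N : m < N
      m<N = <-≤-trans (m<m+n m u0) (≤-reflexive m+r≡N)
      cnt-N : cnt av N ≡ suc (suc (length q))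
      cnt-N = trans (cong (cnt av) (sym m+r≡N))
                    (balance-full (length q) (cnt av (m + r)) (subst (λ z → length q + (z + z) ≡ (n + n) + cnt av (m + r)) m+r≡N u5))

    run-cannot-end : ∀ {m r av} → InvU m r av [] → m + r ≢ N → ⊥
    run-cannot-end {m} {r} {av} inv m+r≢N =
      <-irrefl (sym h≡0) (<-≤-trans u0 (≤-trans (m≤n+m r (cnt av m)) (≤-reflexive (sym cr))))
      where
      open InvU inv
      h≡0 : cnt av (m + r) ≡ 0
      h≡0 = proj₂ (balance-end (m + r) (cnt av (m + r)) (s≤s⁻¹ (≤∧≢⇒< u3 m+r≢N)) u5)
      cr : cnt av (m + r) ≡ cnt av m + r
      cr = cnt-run av m r (λ u m<u u≤ → u2 u m<u (≤-trans u≤ u3))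

    code-innerBlock : ∀ m r w σ₂ q₂ → All (_< (m + r)) w → HeadGt (m + r) σ₂ → ΦBlocks (m + r) (blocks σ₂) ≡ q₂ →
      ΦBlocks m (blocks ((m + r) ∷ w ++ σ₂)) ≡ replicate r U ++ D ∷ replicate (length w) D ++ q₂
    code-innerBlock m r w .(x₂ ∷ xs₂) q₂ w<M (x₂ , xs₂ , refl , M<x₂) rest =
      trans (cong (ΦBlocks m) (blocks-char M w (x₂ ∷ xs₂) w<M (λ { y ys refl → <-asym M<x₂ })))
      (trans (cong (λ bs → ΦBlocks m ((M , w) ∷ bs)) (blocks-cons x₂ xs₂))
      (trans (ΦB-cons m M w _ _)
      (cong₂ (λ a b → replicate a U ++ D ∷ replicate (length w) D ++ b) (m+n∸m≡n m r)
             (trans (cong (ΦBlocks M) (sym (blocks-cons x₂ xs₂))) rest))))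
      where M = m + r

    code-lastBlock : ∀ m r τ → m + r ≡ N → All (_< N) τ → NonEmpty τ →
      ΦBlocks m (blocks (N ∷ τ)) ≡ replicate r U ++ Qs τ
    code-lastBlock m r .(y ∷ ys) m+r≡N below (y , ys , refl) =
      trans (cong (ΦBlocks m) single-block)
            (cong (λ a → replicate a U ++ Qs (y ∷ ys)) (trans (cong (_∸ m) (sym m+r≡N)) (m+n∸m≡n m r)))
      where
      single-block : blocks (N ∷ y ∷ ys) ≡ (N , y ∷ ys) ∷ []
      single-block = subst (λ z → blocks (N ∷ z) ≡ (N , y ∷ ys) ∷ blocks []) (++-identityʳ (y ∷ ys))
                       (blocks-char N (y ∷ ys) [] below (λ _ _ ()))

    LocProp : Kind → ℕ → ℕ → Avail → Set
    LocProp k1 m x av = ∀ u → 0 < u → u < x → av u ≡ false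
    LocProp k2 m x av = ∀ u → x < u → u < m → av u ≡ false

    chooseW-spec : ∀ K av m → av m ≡ false → 0 < cnt av m →
      let x = chooseW K av m in 0 < x × x < m × av x ≡ true × LocProp K m x av
    chooseW-spec k1 av m am cp with minS-found av m cp
    ... | mkMS px x≤m ax least = px , ≤∧≢⇒< x≤m (λ e → true≢false (trans (sym ax) (trans (cong av e) am))) , ax , least
    chooseW-spec k2 av m am cp with topBelow-found av (m ∸ 1) (subst (0 <_) (cnt-pred-false av m am) cp)
    ... | mkTB px x≤m-1 ax top =
      px , ≤∸1⇒< x≤m-1 (<-≤-trans px (≤-trans x≤m-1 (m∸n≤m m 1))) , ax , λ u x<u u<m → top u x<u (<⇒≤∸1 u<m)

    locW : ∀ K m x av σ → (∀ u → av u ≡ true → 0 < u × u ≤ N) → LocProp K m x av → Mem σ (remove av x) → Loc K m x σ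
    locW k1 m x av σ range lp mem c d s = straddle
      where
      above : ∀ {c} → c ∈ σ → x < c
      above {c} c∈ with mem-removed mem c∈
      ... | ac , c≢x = ≤∧≢⇒< (≮⇒≥ (λ c<x → true≢false (trans (sym ac) (lp c (proj₁ (range c ac)) c<x)))) (λ e → c≢x (sym e))
      straddle : ¬ Straddles x c d
      straddle (inj₁ (c<x , _)) = <-asym c<x (above (sub∈₁ s))
      straddle (inj₂ (d<x , _)) = <-asym d<x (above (sub∈₂ s))
    locW k2 m x av σ range lp mem c d s x<c x<d = at-least-m (sub∈₁ s) x<c , at-least-m (sub∈₂ s) x<d
      where
      at-least-m : ∀ {c} → c ∈ σ → x < c → m ≤ c
      at-least-m {c} c∈ x<c with mem-removed mem c∈
      ... | ac , _ = ≮⇒≥ (λ c<m → true≢false (trans (sym ac) (lp c x<c c<m)))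

    mutual
      decW-sound : ∀ K m av q → InvW m av q → OutW K m av q (Dc.decW K N m av q)
      decW-sound K m av [] inv = record
        { unique = [] ∷ [] ; mem = mem ; good = (λ N<m → ⊥-elim (<-asym N<m i3)) , tt
        ; split = splitW [] (N ∷ []) [] refl refl [] (N , [] , refl , i3) refl }
        where
        open InvW inv
        -- the path ends at height 0 with m = n, so N is the only unused value
        ends = balance-end m (cnt av m) (s≤s⁻¹ i3) i5
        mem : Mem (N ∷ []) av
        mem v = (λ { (here refl) → i2 N i3 ≤-refl }) , from
          where
          from : av v ≡ true → v ∈ N ∷ []
          from avv with v ≤? m
          ... | yes le = ⊥-elim (true≢false (trans (sym avv) (cnt-zero av m (proj₂ ends) v (proj₁ (i1 v avv)) le)))
          ... | no nle = here (≤-antisym (proj₂ (i1 v avv)) (subst (_< v) (proj₁ ends) (≰⇒> nle)))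
      decW-sound K m av (U ∷ q) inv = record
        { unique = Run.unique ; mem = Run.mem ; good = Run.good
        ; split = splitW [] _ (U ∷ q) refl refl [] Run.headGt Run.code }
        where module Run = OutU (decU-sound K m 1 av q (invW⇒invU inv))
      decW-sound K m av (D ∷ q) inv with chooseW-spec K av m (InvW.i0 inv) (dyckD-pos (InvW.i4 inv))
      ... | px , x<m , ax , lp = record
        { unique = proj₁ xσ ; mem = proj₂ xσ
        ; good = (λ _ → locW K m x av σ (InvW.i1 inv) lp IH.mem) , subst (λ z → Good K z σ) (sym (m≥n⇒m⊔n≡m (<⇒≤ x<m))) IH.good
        ; split = splitW (x ∷ S.word) S.rest S.restCode (cong (x ∷_) S.σ≡) (cong (D ∷_) S.q≡) (x<m ∷ S.word<m) S.headGt S.restΦ }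
        where
        x = chooseW K av m
        σ = Dc.decW K N m (remove av x) q
        module IH = OutW (decW-sound K m (remove av x) q (invW-step x inv px x<m ax))
        module S = SplitW IH.split
        xσ = prepend ax IH.unique IH.mem

      decU-sound : ∀ K m r av q → InvU m r av q → OutU K m r av q (Dc.decU K N m r av q)
      decU-sound K m r av q inv = decU'-sound K (m + r ≡ᵇ N) m r av q refl inv

      decU'-sound : ∀ K b m r av q → (m + r ≡ᵇ N) ≡ b → InvU m r av q → OutU K m r av q (Dc.decU' K N b m r av q)
      decU'-sound K true m r av q eb inv = record
        { unique = proj₁ Nτ ; mem = proj₂ Nτ
        ; good = (λ N<m → ⊥-elim (<-asym N<m m<N)) , subst (λ z → Good K z τ) (sym (m≤n⇒m⊔n≡n (<⇒≤ m<N))) Last.good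
        ; headGt = N , τ , refl , m<N
        ; code = trans (code-lastBlock m r τ m+r≡N below-N Last.nonempty) (cong (λ z → replicate r U ++ z) Last.code) }
        where
        m+r≡N = ≡ᵇ-true⇒≡ (m + r) N eb
        m<N : m < N
        m<N = <-≤-trans (m<m+n m (InvU.u0 inv)) (≤-reflexive m+r≡N)
        τ = Dc.decL K N (remove av N) q
        invL = invU⇒invL inv m+r≡N
        module Last = OutL (decL-sound K (remove av N) q invL)
        Nτ = prepend (InvU.u2 inv N m<N ≤-refl) Last.unique Last.mem
        below-N : All (_< N) τ
        below-N = All.tabulate (λ {v} v∈ → proj₂ (InvL.j1 invL v (proj₁ (Last.mem v) v∈)))
      decU'-sound K false m r av [] eb inv = ⊥-elim (run-cannot-end inv (≡ᵇ-false⇒≢ (m + r) N eb))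
      decU'-sound K false m r av (U ∷ q) eb inv = record
        { unique = Run.unique ; mem = Run.mem ; good = Run.good ; headGt = Run.headGt ; code = trans Run.code (rep-snoc r q) }
        where module Run = OutU (decU-sound K m (suc r) av q (invU-step inv (≡ᵇ-false⇒≢ (m + r) N eb)))
      decU'-sound K false m r av (D ∷ q) eb inv = record
        { unique = proj₁ Mσ ; mem = proj₂ Mσ
        ; good = (λ M<m → ⊥-elim (<-asym M<m m<M)) , subst (λ z → Good K z σ) (sym (m≤n⇒m⊔n≡n (<⇒≤ m<M))) IH.good
        ; headGt = M , σ , refl , m<M
        ; code = trans (cong (λ z → ΦBlocks m (blocks (M ∷ z))) S.σ≡)
                  (trans (code-innerBlock m r S.word S.rest S.restCode S.word<m S.headGt S.restΦ)
                         (cong (λ z → replicate r U ++ D ∷ z) (sym S.q≡))) }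
        where
        M = m + r
        m<M : m < M
        m<M = m<m+n m (InvU.u0 inv)
        σ = Dc.decW K N M (remove av M) q
        module IH = OutW (decW-sound K M (remove av M) q (invU⇒invW inv (≡ᵇ-false⇒≢ M N eb)))
        module S = SplitW IH.split
        Mσ = prepend (InvU.u2 inv M m<M (InvU.u3 inv)) IH.unique IH.mem

    -- after the maximum 0 no word precedes the first block
    split-at-0 : ∀ {σ q} → SplitW 0 σ q → ΦBlocks 0 (blocks σ) ≡ q
    split-at-0 (splitW [] _ _ refl refl [] _ restΦ) = restΦ

    ψ-sound : ∀ K p → length p ≡ n + n → DyckFrom 0 p →
      Permutations.PermSpec N (ψ K N p) × Good K 0 (ψ K N p) × Φ (ψ K N p) ≡ p
    ψ-sound K p lp dp =
      (Out.unique , λ v → mk⇔ (λ v∈ → range-sound N v (proj₁ (Out.mem v) v∈))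
                              (λ (pos , bounded) → proj₂ (Out.mem v) (range-complete N v pos bounded))) ,
      Out.good , split-at-0 Out.split
      where
      inv : InvW 0 (range N) p
      inv = record
        { i1 = range-sound N ; i2 = range-complete N ; i0 = refl ; i3 = s≤s z≤n ; i4 = dp
        ; i5 = trans (+-identityʳ _) (trans lp (sym (+-identityʳ _))) }
      module Out = OutW (decW-sound K 0 (range N) p inv)


open DyckPaths using (two*n; DyckFrom; isDyck⇔; dyckList; dyckList-length; paths-sound; paths-complete; paths-unique)
open Avoidance using (Kind; k1; k2; Tset; Good; avoids⇒good; good⇒avoids)
open Permutations using (PermSpec; perm⇒; perm⇐)
open Decoder using (ψ)
open import Data.Nat using (_+_)
open import Data.Nat.Properties using (+-identityʳ)
open import Data.List using ([]; _∷_; map)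
open import Data.List.Properties using (length-map)
open import Data.List.Membership.Propositional.Properties using (∈-map⁺; ∈-map⁻)
import Data.List.Relation.Unary.All as All
import Data.List.Relation.Unary.All.Properties as AllP
open import Data.List.Relation.Unary.AllPairs using ([]; _∷_)
open import Data.List.Relation.Unary.Any using (here; there)
open import Data.Product using (_,_; proj₁; proj₂)
open import Data.Sum using (inj₁; inj₂)
open import Relation.Binary.PropositionalEquality using (refl; sym; trans; cong; subst)
open import Function.Bundles using (mk⇔; Equivalence)

map-unique : ∀ {A B : Set} (f : A → B) (xs : List A) → Unique xs →
  (∀ {x y} → x ∈ xs → y ∈ xs → f x ≡ f y → x ≡ y) → Unique (map f xs)
map-unique f [] _ _ = []
map-unique f (x ∷ xs) (distinct ∷ u) inj =
  AllP.map⁺ (All.tabulate (λ v∈xs fx≡fv → All.lookup distinct v∈xs (inj (here refl) (there v∈xs) fx≡fv)))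
    ∷ map-unique f xs u (λ p q → inj (there p) (there q))

module Bijection (K : Kind) (n : ℕ) where

  N : ℕ
  N = suc n

  private
    module Enc = DecodeEncode.B n
    module Dec = EncodeDecode.P n

  InS⇒Good : ∀ {σ} → InS (Tset K) N σ → PermSpec N σ × Good K 0 σ
  InS⇒Good (perm , avoids) = perm⇒ perm , avoids⇒good K (proj₁ (perm⇒ perm)) avoids

  Good⇒InS : ∀ {σ} → PermSpec N σ → Good K 0 σ → InS (Tset K) N σ
  Good⇒InS spec good = perm⇐ spec , good⇒avoids K good

  dyck⇒ : ∀ {p} → DyckPrefixOfLength (2 * n) p → length p ≡ n + n × DyckFrom 0 p
  dyck⇒ {p} (len , dyck) = trans len (two*n n) , Equivalence.to (isDyck⇔ p) dyck

  Φ-dyck : ∀ σ → InS (Tset K) N σ → DyckPrefixOfLength (2 * n) (Φ σ)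
  Φ-dyck σ σ∈S with Enc.ψ-Φ K σ (proj₁ (InS⇒Good σ∈S)) (proj₂ (InS⇒Good σ∈S))
  ... | _ , dyck , len = trans len (sym (two*n n)) , Equivalence.from (isDyck⇔ (Φ σ)) dyck

  ψ∘Φ≡id : ∀ σ → InS (Tset K) N σ → ψ K N (Φ σ) ≡ σ
  ψ∘Φ≡id σ σ∈S = Enc.ψ∘Φ K σ (proj₁ (InS⇒Good σ∈S)) (proj₂ (InS⇒Good σ∈S))

  ψ-InS : ∀ p → DyckPrefixOfLength (2 * n) p → InS (Tset K) N (ψ K N p)
  ψ-InS p dp with Dec.ψ-sound K p (proj₁ (dyck⇒ dp)) (proj₂ (dyck⇒ dp))
  ... | spec , good , _ = Good⇒InS spec good

  Φ∘ψ≡id : ∀ p → DyckPrefixOfLength (2 * n) p → Φ (ψ K N p) ≡ p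
  Φ∘ψ≡id p dp = proj₂ (proj₂ (Dec.ψ-sound K p (proj₁ (dyck⇒ dp)) (proj₂ (dyck⇒ dp))))

  Φ-injective : ∀ σ τ → InS (Tset K) N σ → InS (Tset K) N τ → Φ σ ≡ Φ τ → σ ≡ τ
  Φ-injective σ τ σ∈S τ∈S eq = trans (sym (ψ∘Φ≡id σ σ∈S)) (trans (cong (ψ K N) eq) (ψ∘Φ≡id τ τ∈S))

  Φ-surjective : ∀ p → DyckPrefixOfLength (2 * n) p → ∃ λ σ → InS (Tset K) N σ × Φ σ ≡ p
  Φ-surjective p dp = ψ K N p , ψ-InS p dp , Φ∘ψ≡id p dp

  bijective : (∀ σ → InS (Tset K) N σ → DyckPrefixOfLength (2 * n) (Φ σ))
    × (∀ σ τ → InS (Tset K) N σ → InS (Tset K) N τ → Φ σ ≡ Φ τ → σ ≡ τ)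
    × (∀ p → DyckPrefixOfLength (2 * n) p → ∃ λ σ → InS (Tset K) N σ × Φ σ ≡ p)
  bijective = Φ-dyck , Φ-injective , Φ-surjective

  enumeration : Σ (List (List ℕ)) λ L →
    Unique L × (∀ σ → (σ ∈ L) ⇔ InS (Tset K) N σ) × (length L ≡ (2 * n) C n)
  enumeration = map (ψ K N) (dyckList n) ,
    map-unique (ψ K N) (dyckList n) (paths-unique (2 * n) 0) ψ-injective ,
    (λ σ → mk⇔ (listed⇒InS σ) (InS⇒listed σ)) ,
    trans (length-map (ψ K N) (dyckList n)) (dyckList-length n)
    where
    listed-dyck : ∀ {p} → p ∈ dyckList n → DyckPrefixOfLength (2 * n) p
    listed-dyck {p} p∈ with paths-sound (2 * n) 0 p p∈
    ... | len , dyck = len , Equivalence.from (isDyck⇔ p) dyck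
    ψ-injective : ∀ {p q} → p ∈ dyckList n → q ∈ dyckList n → ψ K N p ≡ ψ K N q → p ≡ q
    ψ-injective {p} {q} p∈ q∈ eq =
      trans (sym (Φ∘ψ≡id p (listed-dyck p∈))) (trans (cong Φ eq) (Φ∘ψ≡id q (listed-dyck q∈)))
    listed⇒InS : ∀ σ → σ ∈ map (ψ K N) (dyckList n) → InS (Tset K) N σ
    listed⇒InS σ σ∈ with ∈-map⁻ (ψ K N) σ∈
    ... | p , p∈ , refl = ψ-InS p (listed-dyck p∈)
    InS⇒listed : ∀ σ → InS (Tset K) N σ → σ ∈ map (ψ K N) (dyckList n)
    InS⇒listed σ σ∈S with Φ-dyck σ σ∈S
    ... | len , dyck = subst (_∈ map (ψ K N) (dyckList n)) (ψ∘Φ≡id σ σ∈S)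
      (∈-map⁺ (ψ K N) (paths-complete (2 * n) 0 (Φ σ) len (Equivalence.to (isDyck⇔ (Φ σ)) dyck)))

theorem4 : ∀ (n : ℕ) →
    (∀ (T : List (List ℕ)) → (T ≡ T₁ ⊎ T ≡ T₂) →
    ((∀ σ → InS T (suc n) σ → DyckPrefixOfLength (2 * n) (Φ σ))
    × (∀ σ τ → InS T (suc n) σ → InS T (suc n) τ → Φ σ ≡ Φ τ → σ ≡ τ)
    × (∀ p → DyckPrefixOfLength (2 * n) p → ∃ λ σ → InS T (suc n) σ × Φ σ ≡ p)))
    × (∀ (T : List (List ℕ)) → (T ≡ T₁ ⊎ T ≡ T₂) →
    Σ (List (List ℕ)) λ L →
    Unique L × (∀ σ → (σ ∈ L) ⇔ InS T (suc n) σ) × (length L ≡ (2 * n) C n))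
theorem4 n =
    (λ { T (inj₁ refl) → Bijection.bijective k1 n ; T (inj₂ refl) → Bijection.bijective k2 n })
  , (λ { T (inj₁ refl) → Bijection.enumeration k1 n ; T (inj₂ refl) → Bijection.enumeration k2 n })
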